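{- Let $n\ge4$ be an integer and $\sigma=n(n-1)\eta_{1,n-2}=n(n-1)12\cdots(n-2)\in\mathfrak S_n$. Then: (a) $S(\sigma)_1^*=n\,\eta_{2,n-1}+\sum_{k=4}^{n-1}(-1)^{n+k}\big(k\,\eta_{2,k-1}\sqcup\!\sqcup \delta_{n,k+1}\big)$. (b) $S(\sigma)_2^*=(-1)^{n+1}\big[1\sqcup\!\sqcup(3\sqcup\!\sqcup \delta_{n,5})4+431\sqcup\!\sqcup \delta_{n,5}\big]$. (c) For $3\le j\le n-2$, $S(\sigma)_j^*=(-1)^{n+j+1}\Big[\big(1\sqcup\!\sqcup (j-1)\eta_{2,j-2}-\delta_{j-1,j-2}\eta_{1,j-3}\big)\sqcup\!\sqcup \delta_{n,j+1}+1\sqcup\!\sqcup (j+1)\eta_{2,j-1}\sqcup\!\sqcup \delta_{n,j+2}+\delta_{j+2,j+1}\eta_{1,j-1}\sqcup\!\sqcup \delta_{n,j+3}\Big]$. (d) $S(\sigma)_{n-1}^*=1\sqcup\!\sqcup n\,\eta_{2,n-2}+\big[1\sqcup\!\sqcup (n-2)\eta_{2,n-3}-\delta_{n-2,n-3}\eta_{1,n-4}\big]\sqcup\!\sqcup n$. (e) $S(\sigma)_{n}^*=\delta_{n-1,n-2}\eta_{1,n-3}-1\sqcup\!\sqcup (n-1)\eta_{2,n-2}$.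
   Context: Let $\Bbbk$ be a field of characteristic zero. $\mathfrak S_n$ is the group of permutations of $[n]$, written in one-line notation as words over the positive integers; $\mathfrak S_0=\{\emptyset\}$ (empty word). Identities take place in the $\Bbbk$-vector space with basis all words. Concatenation is extended bilinearly and binds more tightly than shuffle; parenthesized integers such as $(j+1)$ and digits denote single letters. The shuffle product $\sqcup\!\sqcup$ is bilinear, associative, with $\emptyset$ as unit and $au\sqcup\!\sqcup bv=a(u\sqcup\!\sqcup bv)+b(au\sqcup\!\sqcup v)$ for letters $a,b$ and words $u,v$. For a word $w$ with distinct letters, $\mathrm{st}(w)$ is the permutation with the same relative order; $w+m$ adds $m$ to each letter. In the Malvenuto–Reutenauer Hopf algebra $\bigoplus_{n\ge0}\Bbbk\mathfrak S_n$ the product is $\pi\cdot\sigma=\pi\sqcup\!\sqcup(\sigma+m)$ for $\pi\in\mathfrak S_m$, the coproduct is $\Delta(\pi)=\sum_{i=0}^m\mathrm{st}(\pi_1\cdots\pi_i)\otimes\mathrm{st}(\pi_{i+1}\cdots\pi_m)$, and the antipode satisfies $S(\emptyset)=\emptyset$ and $S(\sigma)=-\sum_{i=0}^{n-1}S(\mathrm{st}(\sigma_1\cdots\sigma_i))\cdot\mathrm{st}(\sigma_{i+1}\cdots\sigma_n)$ for $\sigma\in\mathfrak S_n$, $n\ge1$. For $j\in[n]$, $S(\sigma)_j$ is the sum (with coefficients) of terms of $S(\sigma)$ ending in letter $j$, and $S(\sigma)_j^*$ is obtained from it by deleting that final letter $j$ in each term. For integers $k,l$: $\eta_{k,l}=k(k+1)\cdots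 l$ if $k\le l$, $\emptyset$ if $k=l+1$, $0$ (zero vector) if $k\ge l+2$; $\delta_{l,k}=l(l-1)\cdots k$ if $k\le l$, $\emptyset$ if $k=l+1$, $0$ if $k\ge l+2$; anything concatenated or shuffled with $0$ is $0$. Empty sums are $0$. -}

module Defs where

open import Data.Nat as ℕ using (ℕ; zero; suc; _∸_; _<?_; _≤?_)
import Data.Nat.Properties as ℕP
open import Data.Integer as ℤ using (ℤ; 1ℤ; 0ℤ; -1ℤ)
open import Data.List using (List; []; _∷_; _++_; map; concatMap; length; filter; take; drop; reverse; applyUpTo; upTo; foldr)
open import Data.List.Properties using (≡-dec)
open import Data.Product using (_×_; _,_)
open import Relation.Nullary using (yes; no)
open import Relation.Binary.PropositionalEquality using (_≡_)

Word : Set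
Word = List ℕ

-- Finite formal ℤ-linear combinations of words (a term (c , w) means c·w).
Lin : Set
Lin = List (ℤ × Word)

𝟘 : Lin
𝟘 = []

⟪_⟫ : Word → Lin
⟪ w ⟫ = (1ℤ , w) ∷ []

ltr : ℕ → Lin
ltr a = ⟪ a ∷ [] ⟫

coeff : Lin → Word → ℤ
coeff [] w = 0ℤ
coeff ((c , u) ∷ x) w with ≡-dec ℕ._≟_ u w
... | yes _ = c ℤ.+ coeff x w
... | no  _ = coeff x w

infix 4 _≈_
_≈_ : Lin → Lin → Set
x ≈ y = ∀ (w : Word) → coeff x w ≡ coeff y w

infixl 6 _⊕_ _⊖_
_⊕_ : Lin → Lin → Lin
x ⊕ y = x ++ y

scale : ℤ → Lin → Lin
scale c x = map (λ { (d , w) → (c ℤ.* d , w) }) x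

_⊖_ : Lin → Lin → Lin
x ⊖ y = x ++ scale -1ℤ y

sgn : ℕ → ℤ
sgn zero = 1ℤ
sgn (suc m) = ℤ.- sgn m

infixl 8 _·_
_·_ : Lin → Lin → Lin
x · y = concatMap (λ { (c , u) → map (λ { (d , v) → (c ℤ.* d , u ++ v) }) y }) x

shw : Word → Word → Lin
shw [] v = ⟪ v ⟫
shw (a ∷ u) [] = ⟪ a ∷ u ⟫
shw (a ∷ u) (b ∷ v) =
  map (λ { (c , w) → (c , a ∷ w) }) (shw u (b ∷ v)) ++
  map (λ { (c , w) → (c , b ∷ w) }) (shw (a ∷ u) v)

infixl 7 _⧢_
_⧢_ : Lin → Lin → Lin
x ⧢ y = concatMap (λ { (c , u) → concatMap (λ { (d , v) → scale (c ℤ.* d) (shw u v) }) y }) x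

-- η_{k,l} = k(k+1)…l (k ≤ l), ∅ (k = l+1), 0 (k ≥ l+2)
η : ℕ → ℕ → Lin
η k l with k ≤? suc l
... | yes _ = ⟪ applyUpTo (k ℕ.+_) (suc l ∸ k) ⟫
... | no  _ = 𝟘

-- δ_{l,k} = l(l-1)…k (k ≤ l), ∅ (k = l+1), 0 (k ≥ l+2)
δ : ℕ → ℕ → Lin
δ l k with k ≤? suc l
... | yes _ = ⟪ reverse (applyUpTo (k ℕ.+_) (suc l ∸ k)) ⟫
... | no  _ = 𝟘

-- standardization of a word with distinct letters
st : Word → Word
st w = map (λ a → suc (length (filter (λ b → b <? a) w))) w

shift : ℕ → Word → Word
shift m = map (m ℕ.+_)

-- Malvenuto–Reutenauer product π·σ = π ⧢ (σ + m), π ∈ 𝔖_m, extended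
-- linearly in the first argument
mrProd : Lin → Word → Lin
mrProd x σ = concatMap (λ { (c , π) → scale c (shw π (shift (length π) σ)) }) x

-- antipode with fuel (fuel ≥ length of the word suffices)
antipodeF : ℕ → Word → Lin
antipodeF zero _ = ⟪ [] ⟫
antipodeF (suc f) [] = ⟪ [] ⟫
antipodeF (suc f) (a ∷ w) =
  scale -1ℤ (concatMap (λ i → mrProd (antipodeF f (st (take i (a ∷ w)))) (st (drop i (a ∷ w))))
                       (upTo (length (a ∷ w))))

S : Word → Lin
S σ = antipodeF (length σ) σ

-- S(σ)_j^* : terms ending in letter j, with that final letter deleted
dropLastIf : ℕ → ℤ × Word → Lin
dropLastIf j (c , w) with reverse w
... | [] = 𝟘
... | a ∷ r with a ℕ.≟ j
...   | yes _ = (c , reverse r) ∷ []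
...   | no  _ = 𝟘

S* : Word → ℕ → Lin
S* σ j = concatMap (dropLastIf j) (S σ)

-- sum over k = a, …, b (empty if b < a)
Σ[_to_] : ℕ → ℕ → (ℕ → Lin) → Lin
Σ[ a to b ] f = concatMap (λ i → f (a ℕ.+ i)) (upTo (suc b ∸ a))

σₙ : ℕ → Word
σₙ n = n ∷ (n ∸ 1) ∷ applyUpTo suc (n ∸ 2)

{-# OPTIONS --safe #-}
module Submission where

-- Write Sₙ = S(σₙ). Cutting σₙ after i ≥ 2 letters, the prefix standardizes to σᵢ and the suffix
-- to an increasing word, so the defining recursion of the antipode reads
--   Σ_{i=2}^{n} Sᵢ ⧢ η_{i+1,n} = 1 ⧢ n η_{2,n-1} − σₙ.
-- Taking the terms ending in j commutes with (⧢ η_{i+1,n}) except for an extra [j = n] Sᵢ ⧢ η_{i+1,n-1},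
-- so for j < n the family (Sᵢ)ⱼ* satisfies the same triangular recursion, with the explicit right-hand
-- side (1 ⧢ n η_{2,n-1} − σₙ)ⱼ*. The i = n summand is the unknown itself, so a starting value determines
-- the solution, and each claimed formula is checked to satisfy the recursion: written as an alternating
-- sum of P ⧢ δ_{i,k}, it collapses by the telescoping identity Σᵢ (−1)ⁱ δ_{i,k} ⧢ η_{i+1,n} = 0 for k ≤ n.
-- Part (e) is the case j = n, where the extra term reproduces the recursion at n − 1, and (d) is the
-- formula of (c) evaluated at n = j + 1.

open import Defs

-- ℤ arithmetic is opened only inside this module, leaving ℕ's _+_ to the statement of lemma3p6.
module _ where

  open import Data.Nat as ℕ using (ℕ; zero; suc; _≤_; _<_; _∸_; z≤n; s≤s; _<?_)
  import Data.Nat.Properties as ℕP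
  open import Data.Integer using (ℤ; 0ℤ; 1ℤ; -1ℤ; _+_; _*_; -_; _-_)
  open import Data.Integer.Properties
    using (+-identityˡ; +-identityʳ; +-assoc; +-comm; +-inverseʳ; *-identityˡ; *-identityʳ;
           *-zeroˡ; *-zeroʳ; *-assoc; *-comm; *-distribˡ-+; -1*i≡-i; neg-distribˡ-*)
  open import Data.Integer.Tactic.RingSolver using (solve-∀)
  open import Data.List
    using (List; []; _∷_; _++_; _∷ʳ_; map; concatMap; applyUpTo; reverse; length; filter; take; drop;
           initLast; _∷ʳ′_)
  import Data.List.Properties as LP
  open import Data.Product using (_×_; _,_; proj₁; proj₂)
  open import Data.Sum using (inj₁; inj₂)
  open import Data.Empty using (⊥-elim)
  open import Relation.Nullary using (Dec; yes; no; ¬_)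
  open import Relation.Binary.Definitions using (tri<; tri≈; tri>)
  open import Relation.Binary.PropositionalEquality
  open import Data.Nat.Induction using (<-rec)

  ev : (Word → ℤ) → Lin → ℤ
  ev G [] = 0ℤ
  ev G ((c , u) ∷ x) = c * G u + ev G x

  -- A Lin may repeat words; two are compared through every test function Word → ℤ,
  -- which is the same as comparing coefficients (≋⇒≈).
  infix 4 _≋_
  record _≋_ (x y : Lin) : Set where
    constructor mk≋
    field at : ∀ G → ev G x ≡ ev G y
  open _≋_

  ev-++ : ∀ G x y → ev G (x ++ y) ≡ ev G x + ev G y
  ev-++ G [] y = sym (+-identityˡ _)
  ev-++ G ((c , u) ∷ x) y = trans (cong (c * G u +_) (ev-++ G x y)) (sym (+-assoc (c * G u) _ _))

  ev-scale : ∀ G c x → ev G (scale c x) ≡ c * ev G x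
  ev-scale G c [] = sym (*-zeroʳ c)
  ev-scale G c ((d , u) ∷ x) =
    trans (cong₂ _+_ (*-assoc c d (G u)) (ev-scale G c x)) (sym (*-distribˡ-+ c (d * G u) (ev G x)))

  ev-⊖ : ∀ G x y → ev G (x ⊖ y) ≡ ev G x - ev G y
  ev-⊖ G x y = trans (ev-++ G x (scale -1ℤ y)) (cong (ev G x +_) (trans (ev-scale G -1ℤ y) (-1*i≡-i (ev G y))))

  ev-⟪⟫ : ∀ G w → ev G ⟪ w ⟫ ≡ G w
  ev-⟪⟫ G w = trans (+-identityʳ _) (*-identityˡ (G w))

  ev-cong : ∀ {F F'} x → (∀ u → F u ≡ F' u) → ev F x ≡ ev F' x
  ev-cong [] e = refl
  ev-cong ((c , u) ∷ x) e = cong₂ (λ a b → c * a + b) (e u) (ev-cong x e)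

  ev-+ : ∀ F F' x → ev (λ u → F u + F' u) x ≡ ev F x + ev F' x
  ev-+ F F' [] = refl
  ev-+ F F' ((c , u) ∷ x) = trans (cong (c * (F u + F' u) +_) (ev-+ F F' x)) (distrib c (F u) (F' u) (ev F x) (ev F' x))
    where
    distrib : ∀ c a b p q → c * (a + b) + (p + q) ≡ c * a + p + (c * b + q)
    distrib = solve-∀

  ev-* : ∀ k F x → ev (λ u → k * F u) x ≡ k * ev F x
  ev-* k F [] = sym (*-zeroʳ k)
  ev-* k F ((c , u) ∷ x) = trans (cong (c * (k * F u) +_) (ev-* k F x)) (distrib c k (F u) (ev F x))
    where
    distrib : ∀ c k a p → c * (k * a) + k * p ≡ k * (c * a + p)
    distrib = solve-∀

  ev-0 : ∀ x → ev (λ _ → 0ℤ) x ≡ 0ℤ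
  ev-0 [] = refl
  ev-0 ((c , u) ∷ x) = trans (cong₂ _+_ (*-zeroʳ c) (ev-0 x)) refl

  ev-swap : ∀ (H : Word → Word → ℤ) x y →
    ev (λ u → ev (H u) y) x ≡ ev (λ v → ev (λ u → H u v) x) y
  ev-swap H [] y = sym (ev-0 y)
  ev-swap H ((c , u) ∷ x) y =
    trans (cong (c * ev (H u) y +_) (ev-swap H x y))
    (trans (cong (_+ ev (λ v → ev (λ u₁ → H u₁ v) x) y) (sym (ev-* c (H u) y)))
           (sym (ev-+ (λ v → c * H u v) (λ v → ev (λ u₁ → H u₁ v) x) y)))

  ev-concatMap : ∀ G F (f : ℤ × Word → Lin) x → (∀ c u → ev G (f (c , u)) ≡ c * F u) →
    ev G (concatMap f x) ≡ ev F x
  ev-concatMap G F f [] e = refl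
  ev-concatMap G F f ((c , u) ∷ x) e =
    trans (ev-++ G (f (c , u)) (concatMap f x)) (cong₂ _+_ (e c u) (ev-concatMap G F f x e))

  ev-map : ∀ G F (f : ℤ × Word → ℤ × Word) x → (∀ c u → proj₁ (f (c , u)) * G (proj₂ (f (c , u))) ≡ c * F u) →
    ev G (map f x) ≡ ev F x
  ev-map G F f [] e = refl
  ev-map G F f ((c , u) ∷ x) e = cong₂ _+_ (e c u) (ev-map G F f x e)

  ev-⧢ : ∀ G x y → ev G (x ⧢ y) ≡ ev (λ u → ev (λ v → ev G (shw u v)) y) x
  ev-⧢ G x y = ev-concatMap G _ _ x (λ c u →
    trans (ev-concatMap G (λ v → c * ev G (shw u v)) _ y (λ d v →
             trans (ev-scale G (c * d) (shw u v)) (reassoc c d (ev G (shw u v)))))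
          (ev-* c (λ v → ev G (shw u v)) y))
    where
    reassoc : ∀ c d a → c * d * a ≡ d * (c * a)
    reassoc = solve-∀

  ev-· : ∀ G x y → ev G (x · y) ≡ ev (λ u → ev (λ v → G (u ++ v)) y) x
  ev-· G x y = ev-concatMap G _ _ x (λ c u →
    trans (ev-map G (λ v → c * G (u ++ v)) _ y (λ d v → reassoc c d (G (u ++ v))))
          (ev-* c (λ v → G (u ++ v)) y))
    where
    reassoc : ∀ c d a → c * d * a ≡ d * (c * a)
    reassoc = solve-∀

  wordIndicator : Word → Word → ℤ
  wordIndicator w u with LP.≡-dec ℕ._≟_ u w
  ... | yes _ = 1ℤ
  ... | no _ = 0ℤ

  coeff-ev : ∀ x w → coeff x w ≡ ev (wordIndicator w) x
  coeff-ev [] w = refl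
  coeff-ev ((c , u) ∷ x) w with LP.≡-dec ℕ._≟_ u w
  ... | yes _ = cong₂ _+_ (sym (*-identityʳ c)) (coeff-ev x w)
  ... | no _ = trans (coeff-ev x w) (sym (trans (cong (_+ ev (wordIndicator w) x) (*-zeroʳ c)) (+-identityˡ _)))

  ≋⇒≈ : ∀ {x y} → x ≋ y → x ≈ y
  ≋⇒≈ {x} {y} e w = trans (coeff-ev x w) (trans (at e (wordIndicator w)) (sym (coeff-ev y w)))

  ≋-refl : ∀ {x} → x ≋ x
  ≋-refl = mk≋ λ G → refl

  ≋-reflexive : ∀ {x y} → x ≡ y → x ≋ y
  ≋-reflexive refl = ≋-refl

  ≋-sym : ∀ {x y} → x ≋ y → y ≋ x
  ≋-sym e = mk≋ λ G → sym (at e G)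

  ≋-trans : ∀ {x y z} → x ≋ y → y ≋ z → x ≋ z
  ≋-trans e f = mk≋ λ G → trans (at e G) (at f G)

  module ≋-Reasoning where
    infix 1 begin_
    infixr 2 _≋⟨_⟩_
    infix 3 _∎

    begin_ : ∀ {x y} → x ≋ y → x ≋ y
    begin e = e

    _≋⟨_⟩_ : ∀ x {y z} → x ≋ y → y ≋ z → x ≋ z
    x ≋⟨ e ⟩ f = ≋-trans e f

    _∎ : ∀ x → x ≋ x
    x ∎ = ≋-refl

  ⊕-cong : ∀ {x x' y y'} → x ≋ x' → y ≋ y' → x ⊕ y ≋ x' ⊕ y'
  ⊕-cong {x} {x'} {y} {y'} e f = mk≋ λ G →
    trans (ev-++ G x y) (trans (cong₂ _+_ (at e G) (at f G)) (sym (ev-++ G x' y')))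

  ⊕-congˡ : ∀ {x x'} y → x ≋ x' → x ⊕ y ≋ x' ⊕ y
  ⊕-congˡ y e = ⊕-cong e (≋-refl {y})

  ⊕-congʳ : ∀ x {y y'} → y ≋ y' → x ⊕ y ≋ x ⊕ y'
  ⊕-congʳ x e = ⊕-cong (≋-refl {x}) e

  ⊖-cong : ∀ {x x' y y'} → x ≋ x' → y ≋ y' → x ⊖ y ≋ x' ⊖ y'
  ⊖-cong {x} {x'} {y} {y'} e f = mk≋ λ G →
    trans (ev-⊖ G x y) (trans (cong₂ _-_ (at e G) (at f G)) (sym (ev-⊖ G x' y')))

  scale-cong : ∀ c {x y} → x ≋ y → scale c x ≋ scale c y
  scale-cong c {x} {y} e = mk≋ λ G → trans (ev-scale G c x) (trans (cong (c *_) (at e G)) (sym (ev-scale G c y)))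

  scale-congˡ : ∀ {c d} x → c ≡ d → scale c x ≋ scale d x
  scale-congˡ x refl = ≋-refl

  ⧢-cong : ∀ {x x' y y'} → x ≋ x' → y ≋ y' → x ⧢ y ≋ x' ⧢ y'
  ⧢-cong {x} {x'} {y} {y'} e f = mk≋ λ G →
    trans (ev-⧢ G x y) (trans (ev-cong x (λ u → at f (λ v → ev G (shw u v))))
      (trans (at e (λ u → ev (λ v → ev G (shw u v)) y')) (sym (ev-⧢ G x' y'))))

  ⧢-congˡ : ∀ {x x'} y → x ≋ x' → x ⧢ y ≋ x' ⧢ y
  ⧢-congˡ y e = ⧢-cong e (≋-refl {y})

  ⧢-congʳ : ∀ x {y y'} → y ≋ y' → x ⧢ y ≋ x ⧢ y'
  ⧢-congʳ x e = ⧢-cong (≋-refl {x}) e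

  ·-cong : ∀ {x x' y y'} → x ≋ x' → y ≋ y' → x · y ≋ x' · y'
  ·-cong {x} {x'} {y} {y'} e f = mk≋ λ G →
    trans (ev-· G x y) (trans (ev-cong x (λ u → at f (λ v → G (u ++ v))))
      (trans (at e (λ u → ev (λ v → G (u ++ v)) y')) (sym (ev-· G x' y'))))

  ·-congˡ : ∀ {x x'} y → x ≋ x' → x · y ≋ x' · y
  ·-congˡ y e = ·-cong e (≋-refl {y})

  ·-congʳ : ∀ x {y y'} → y ≋ y' → x · y ≋ x · y'
  ·-congʳ x e = ·-cong (≋-refl {x}) e

  ⊕-identityˡ : ∀ x → 𝟘 ⊕ x ≋ x
  ⊕-identityˡ x = ≋-refl

  ⊕-identityʳ : ∀ x → x ⊕ 𝟘 ≋ x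
  ⊕-identityʳ x = ≋-reflexive (LP.++-identityʳ x)

  ⊕-comm : ∀ x y → x ⊕ y ≋ y ⊕ x
  ⊕-comm x y = mk≋ λ G → trans (ev-++ G x y) (trans (+-comm (ev G x) (ev G y)) (sym (ev-++ G y x)))

  scale-⊕ : ∀ c x y → scale c (x ⊕ y) ≋ scale c x ⊕ scale c y
  scale-⊕ c x y = ≋-reflexive (LP.map-++ _ x y)

  scale-scale : ∀ c d x → scale c (scale d x) ≋ scale (c * d) x
  scale-scale c d x = mk≋ λ G → trans (ev-scale G c (scale d x)) (trans (cong (c *_) (ev-scale G d x))
    (trans (sym (*-assoc c d _)) (sym (ev-scale G (c * d) x))))

  scale-1 : ∀ x → scale 1ℤ x ≋ x
  scale-1 x = mk≋ λ G → trans (ev-scale G 1ℤ x) (*-identityˡ _)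

  scale-zero : ∀ c {x} → x ≋ 𝟘 → scale c x ≋ 𝟘
  scale-zero c e = scale-cong c e

  ⧢-⊕ˡ : ∀ x y z → (x ⊕ y) ⧢ z ≋ x ⧢ z ⊕ y ⧢ z
  ⧢-⊕ˡ x y z = ≋-reflexive (LP.concatMap-++ _ x y)

  ⧢-⊕ʳ : ∀ x y z → x ⧢ (y ⊕ z) ≋ x ⧢ y ⊕ x ⧢ z
  ⧢-⊕ʳ x y z = mk≋ λ G → trans (ev-⧢ G x (y ⊕ z)) (trans (ev-cong x (λ u → ev-++ _ y z))
    (trans (ev-+ _ _ x) (trans (cong₂ _+_ (sym (ev-⧢ G x y)) (sym (ev-⧢ G x z))) (sym (ev-++ G (x ⧢ y) (x ⧢ z))))))

  ⧢-scaleˡ : ∀ c x y → scale c x ⧢ y ≋ scale c (x ⧢ y)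
  ⧢-scaleˡ c x y = mk≋ λ G → trans (ev-⧢ G (scale c x) y) (trans (ev-scale _ c x)
    (trans (cong (c *_) (sym (ev-⧢ G x y))) (sym (ev-scale G c (x ⧢ y)))))

  ⧢-scaleʳ : ∀ c x y → x ⧢ scale c y ≋ scale c (x ⧢ y)
  ⧢-scaleʳ c x y = mk≋ λ G → trans (ev-⧢ G x (scale c y)) (trans (ev-cong x (λ u → ev-scale _ c y))
    (trans (ev-* c _ x) (trans (cong (c *_) (sym (ev-⧢ G x y))) (sym (ev-scale G c (x ⧢ y))))))

  ⧢-zeroˡ : ∀ x → 𝟘 ⧢ x ≋ 𝟘
  ⧢-zeroˡ x = ≋-refl

  ⧢-zeroʳ : ∀ x → x ⧢ 𝟘 ≋ 𝟘
  ⧢-zeroʳ x = mk≋ λ G → trans (ev-⧢ G x 𝟘) (ev-0 x)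

  ·-⊕ˡ : ∀ x y z → (x ⊕ y) · z ≋ x · z ⊕ y · z
  ·-⊕ˡ x y z = ≋-reflexive (LP.concatMap-++ _ x y)

  ·-⊕ʳ : ∀ x y z → x · (y ⊕ z) ≋ x · y ⊕ x · z
  ·-⊕ʳ x y z = mk≋ λ G → trans (ev-· G x (y ⊕ z)) (trans (ev-cong x (λ u → ev-++ (λ v → G (u ++ v)) y z))
    (trans (ev-+ _ _ x) (trans (cong₂ _+_ (sym (ev-· G x y)) (sym (ev-· G x z))) (sym (ev-++ G (x · y) (x · z))))))

  ·-scaleʳ : ∀ c x y → x · scale c y ≋ scale c (x · y)
  ·-scaleʳ c x y = mk≋ λ G → trans (ev-· G x (scale c y))
    (trans (ev-cong x (λ u → ev-scale (λ v → G (u ++ v)) c y))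
    (trans (ev-* c _ x) (trans (cong (c *_) (sym (ev-· G x y))) (sym (ev-scale G c (x · y))))))

  ·-zeroʳ : ∀ x → x · 𝟘 ≋ 𝟘
  ·-zeroʳ x = mk≋ λ G → trans (ev-· G x 𝟘) (ev-0 x)

  ·-assoc : ∀ x y z → (x · y) · z ≋ x · (y · z)
  ·-assoc x y z = mk≋ λ G → trans (ev-· G (x · y) z) (trans (ev-· _ x y)
    (trans (ev-cong x (λ u → trans (ev-cong y (λ v → ev-cong z (λ w → cong G (LP.++-assoc u v w))))
       (sym (ev-· (λ t → G (u ++ t)) y z)))) (sym (ev-· G x (y · z)))))

  ⟪⟫-· : ∀ u v → ⟪ u ⟫ · ⟪ v ⟫ ≋ ⟪ u ++ v ⟫
  ⟪⟫-· u v = mk≋ λ G → trans (ev-· G ⟪ u ⟫ ⟪ v ⟫) (trans (ev-⟪⟫ (λ u' → ev (λ v' → G (u' ++ v')) ⟪ v ⟫) u)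
    (trans (ev-⟪⟫ (λ v' → G (u ++ v')) v) (sym (ev-⟪⟫ G (u ++ v)))))

  ltr-·-⟪⟫ : ∀ a w → ltr a · ⟪ w ⟫ ≋ ⟪ a ∷ w ⟫
  ltr-·-⟪⟫ a w = ⟪⟫-· (a ∷ []) w

  ∅-· : ∀ x → ⟪ [] ⟫ · x ≋ x
  ∅-· x = mk≋ λ G → trans (ev-· G ⟪ [] ⟫ x) (ev-⟪⟫ (λ u → ev (λ v → G (u ++ v)) x) [])


  Sh : Word → Word → (Word → ℤ) → ℤ
  Sh u v G = ev G (shw u v)

  Sh-[]ˡ : ∀ v G → Sh [] v G ≡ G v
  Sh-[]ˡ v G = ev-⟪⟫ G v

  Sh-[]ʳ : ∀ u G → Sh u [] G ≡ G u
  Sh-[]ʳ [] G = ev-⟪⟫ G []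
  Sh-[]ʳ (a ∷ u) G = ev-⟪⟫ G (a ∷ u)

  Sh-∷ : ∀ a u b v G → Sh (a ∷ u) (b ∷ v) G ≡ Sh u (b ∷ v) (λ w → G (a ∷ w)) + Sh (a ∷ u) v (λ w → G (b ∷ w))
  Sh-∷ a u b v G = trans (ev-++ G (map _ (shw u (b ∷ v))) (map _ (shw (a ∷ u) v)))
    (cong₂ _+_ (ev-map G (λ w → G (a ∷ w)) _ (shw u (b ∷ v)) (λ c w → refl))
               (ev-map G (λ w → G (b ∷ w)) _ (shw (a ∷ u) v) (λ c w → refl)))

  Sh-cong : ∀ u v {G G'} → (∀ w → G w ≡ G' w) → Sh u v G ≡ Sh u v G'
  Sh-cong u v e = ev-cong (shw u v) e

  Sh-+ : ∀ u v F F' → Sh u v (λ w → F w + F' w) ≡ Sh u v F + Sh u v F'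
  Sh-+ u v F F' = ev-+ F F' (shw u v)

  Sh-* : ∀ u v k F → Sh u v (λ w → k * F w) ≡ k * Sh u v F
  Sh-* u v k F = ev-* k F (shw u v)

  Sh-assoc : ∀ u v s G → Sh u v (λ t → Sh t s G) ≡ Sh v s (λ r → Sh u r G)
  Sh-assoc [] v s G = trans (Sh-[]ˡ v (λ t → Sh t s G)) (Sh-cong v s (λ r → sym (Sh-[]ˡ r G)))
  Sh-assoc u@(_ ∷ _) [] s G = trans (Sh-[]ʳ u (λ t → Sh t s G)) (sym (Sh-[]ˡ s (λ r → Sh u r G)))
  Sh-assoc u@(_ ∷ _) v@(_ ∷ _) [] G = trans (Sh-cong u v (λ t → Sh-[]ʳ t G)) (sym (Sh-[]ʳ v (λ r → Sh u r G)))
  Sh-assoc u@(a ∷ u') v@(b ∷ v') s@(c ∷ s') G =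
    begin
      Sh u v (λ t → Sh t s G)
    ≡⟨ Sh-∷ a u' b v' _ ⟩
      Sh u' v (λ t → Sh (a ∷ t) s G) + Sh u v' (λ t → Sh (b ∷ t) s G)
    ≡⟨ cong₂ _+_ (trans (Sh-cong u' v (λ t → Sh-∷ a t c s' G)) (Sh-+ u' v _ _))
                 (trans (Sh-cong u v' (λ t → Sh-∷ b t c s' G)) (Sh-+ u v' _ _)) ⟩
      (T₁ + T₂) + (T₃ + T₄)
    ≡⟨ interchange T₁ T₂ T₃ T₄ ⟩
      T₁ + T₃ + (T₂ + T₄)
    ≡⟨ cong₂ _+_ (cong₂ _+_ (Sh-assoc u' v s (λ w → G (a ∷ w))) (Sh-assoc u v' s (λ w → G (b ∷ w))))
         (trans (sym (Sh-∷ a u' b v' (λ t → Sh t s' (λ w → G (c ∷ w))))) (Sh-assoc u v s' (λ w → G (c ∷ w)))) ⟩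
      R₁ + R₃ + R₂₄
    ≡⟨ cong (λ z → z + R₃ + R₂₄) (Sh-∷ b v' c s' (λ r → Sh u' r (λ w → G (a ∷ w)))) ⟩
      R₁ₐ + R₁ᵦ + R₃ + R₂₄
    ≡⟨ interchange′ R₁ₐ R₁ᵦ R₃ R₂₄ ⟩
      (R₁ₐ + R₃) + (R₁ᵦ + R₂₄)
    ≡⟨ cong₂ _+_ (sym (trans (Sh-cong v' s (λ w → Sh-∷ a u' b w G)) (Sh-+ v' s _ _)))
                 (sym (trans (Sh-cong v s' (λ w → Sh-∷ a u' c w G)) (Sh-+ v s' _ _))) ⟩
      Sh v' s (λ w → Sh u (b ∷ w) G) + Sh v s' (λ w → Sh u (c ∷ w) G)
    ≡⟨ sym (Sh-∷ b v' c s' _) ⟩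
      Sh v s (λ r → Sh u r G)
    ∎
    where
    open ≡-Reasoning
    T₁ = Sh u' v (λ t → Sh t s (λ w → G (a ∷ w)))
    T₂ = Sh u' v (λ t → Sh (a ∷ t) s' (λ w → G (c ∷ w)))
    T₃ = Sh u v' (λ t → Sh t s (λ w → G (b ∷ w)))
    T₄ = Sh u v' (λ t → Sh (b ∷ t) s' (λ w → G (c ∷ w)))
    R₁ = Sh v s (λ r → Sh u' r (λ w → G (a ∷ w)))
    R₃ = Sh v' s (λ r → Sh u r (λ w → G (b ∷ w)))
    R₂₄ = Sh v s' (λ r → Sh u r (λ w → G (c ∷ w)))
    R₁ₐ = Sh v' s (λ w → Sh u' (b ∷ w) (λ w → G (a ∷ w)))
    R₁ᵦ = Sh v s' (λ w → Sh u' (c ∷ w) (λ w → G (a ∷ w)))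
    interchange : ∀ p q r t → (p + q) + (r + t) ≡ p + r + (q + t)
    interchange = solve-∀
    interchange′ : ∀ p q r t → p + q + r + t ≡ (p + r) + (q + t)
    interchange′ = solve-∀

  ⧢-assoc : ∀ x y z → (x ⧢ y) ⧢ z ≋ x ⧢ (y ⧢ z)
  ⧢-assoc x y z = mk≋ λ G →
    begin
      ev G ((x ⧢ y) ⧢ z)
    ≡⟨ trans (ev-⧢ G (x ⧢ y) z) (ev-⧢ _ x y) ⟩
      ev (λ u → ev (λ v → Sh u v (λ t → ev (λ s → Sh t s G) z)) y) x
    ≡⟨ ev-cong x (λ u → ev-cong y (λ v →
         trans (ev-swap (λ t s → Sh t s G) (shw u v) z) (ev-cong z (λ s → Sh-assoc u v s G)))) ⟩
      ev (λ u → ev (λ v → ev (λ s → Sh v s (λ r → Sh u r G)) z) y) x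
    ≡⟨ ev-cong x (λ u → sym (ev-⧢ (λ r → Sh u r G) y z)) ⟩
      ev (λ u → ev (λ r → Sh u r G) (y ⧢ z)) x
    ≡⟨ sym (ev-⧢ G x (y ⧢ z)) ⟩
      ev G (x ⧢ (y ⧢ z))
    ∎
    where open ≡-Reasoning

  ∅-⧢ : ∀ x → ⟪ [] ⟫ ⧢ x ≋ x
  ∅-⧢ x = mk≋ λ G → trans (ev-⧢ G ⟪ [] ⟫ x) (trans (ev-⟪⟫ (λ u → ev (λ v → Sh u v G) x) [])
    (ev-cong x (λ v → Sh-[]ˡ v G)))

  ⧢-∅ : ∀ x → x ⧢ ⟪ [] ⟫ ≋ x
  ⧢-∅ x = mk≋ λ G → trans (ev-⧢ G x ⟪ [] ⟫) (ev-cong x (λ u → trans (ev-⟪⟫ (λ v → Sh u v G) []) (Sh-[]ʳ u G)))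

  ⧢-scale-∅ : ∀ x c → x ⧢ scale c ⟪ [] ⟫ ≋ scale c x
  ⧢-scale-∅ x c = ≋-trans (⧢-scaleʳ c x ⟪ [] ⟫) (scale-cong c (⧢-∅ x))

  ev-ltr-· : ∀ G a x → ev G (ltr a · x) ≡ ev (λ v → G (a ∷ v)) x
  ev-ltr-· G a x = trans (ev-· G (ltr a) x) (ev-⟪⟫ (λ u → ev (λ v → G (u ++ v)) x) (a ∷ []))

  ltr-·-⧢-ltr-· : ∀ a x b y →
    (ltr a · x) ⧢ (ltr b · y) ≋ ltr a · (x ⧢ (ltr b · y)) ⊕ ltr b · ((ltr a · x) ⧢ y)
  ltr-·-⧢-ltr-· a x b y = mk≋ λ G →
    begin
      ev G ((ltr a · x) ⧢ (ltr b · y))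
    ≡⟨ trans (ev-⧢ G (ltr a · x) (ltr b · y))
        (trans (ev-ltr-· _ a x) (ev-cong x (λ u → ev-ltr-· (λ s → Sh (a ∷ u) s G) b y))) ⟩
      ev (λ u → ev (λ v → Sh (a ∷ u) (b ∷ v) G) y) x
    ≡⟨ trans (ev-cong x (λ u → trans (ev-cong y (λ v → Sh-∷ a u b v G)) (ev-+ _ _ y))) (ev-+ _ _ x) ⟩
      ev (λ u → ev (λ v → Sh u (b ∷ v) (λ w → G (a ∷ w))) y) x + ev (λ u → ev (λ v → Sh (a ∷ u) v (λ w → G (b ∷ w))) y) x
    ≡⟨ cong₂ _+_
        (sym (trans (ev-ltr-· G a (x ⧢ (ltr b · y))) (trans (ev-⧢ (λ w → G (a ∷ w)) x (ltr b · y))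
           (ev-cong x (λ u → ev-ltr-· (λ s → Sh u s (λ w → G (a ∷ w))) b y)))))
        (sym (trans (ev-ltr-· G b ((ltr a · x) ⧢ y)) (trans (ev-⧢ (λ w → G (b ∷ w)) (ltr a · x) y)
           (ev-ltr-· (λ t → ev (λ s → Sh t s (λ w → G (b ∷ w))) y) a x)))) ⟩
      ev G (ltr a · (x ⧢ (ltr b · y))) + ev G (ltr b · ((ltr a · x) ⧢ y))
    ≡⟨ sym (ev-++ G (ltr a · (x ⧢ (ltr b · y))) (ltr b · ((ltr a · x) ⧢ y))) ⟩
      ev G (ltr a · (x ⧢ (ltr b · y)) ⊕ ltr b · ((ltr a · x) ⧢ y))
    ∎
    where open ≡-Reasoning

  Sh-∷ʳ : ∀ u v a b G → Sh (u ∷ʳ a) (v ∷ʳ b) G ≡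
    Sh u (v ∷ʳ b) (λ w → G (w ∷ʳ a)) + Sh (u ∷ʳ a) v (λ w → G (w ∷ʳ b))
  Sh-∷ʳ [] [] a b G =
    trans (Sh-∷ a [] b [] G)
    (trans (cong₂ _+_ (Sh-[]ˡ (b ∷ []) (λ w → G (a ∷ w))) (Sh-[]ʳ (a ∷ []) (λ w → G (b ∷ w))))
    (trans (+-comm (G (a ∷ b ∷ [])) (G (b ∷ a ∷ [])))
    (sym (cong₂ _+_ (Sh-[]ˡ (b ∷ []) (λ w → G (w ∷ʳ a))) (Sh-[]ʳ (a ∷ []) (λ w → G (w ∷ʳ b)))))))
  Sh-∷ʳ (x ∷ u') [] a b G =
    trans (Sh-∷ x (u' ∷ʳ a) b [] G)
    (trans (cong₂ _+_ (trans (Sh-∷ʳ u' [] a b (λ w → G (x ∷ w)))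
                             (cong (P +_) (Sh-[]ʳ (u' ∷ʳ a) (λ w → G (x ∷ (w ∷ʳ b))))))
                      (Sh-[]ʳ (x ∷ (u' ∷ʳ a)) (λ w → G (b ∷ w))))
    (trans (swap₂₃ P (G (x ∷ ((u' ∷ʳ a) ∷ʳ b))) (G (b ∷ x ∷ (u' ∷ʳ a))))
    (sym (cong₂ _+_ (trans (Sh-∷ x u' b [] (λ w → G (w ∷ʳ a))) (cong (P +_) (Sh-[]ʳ (x ∷ u') (λ w → G ((b ∷ w) ∷ʳ a)))))
                    (Sh-[]ʳ (x ∷ (u' ∷ʳ a)) (λ w → G (w ∷ʳ b)))))))
    where
    P = Sh u' (b ∷ []) (λ w → G (x ∷ (w ∷ʳ a)))
    swap₂₃ : ∀ p q r → p + q + r ≡ p + r + q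
    swap₂₃ = solve-∀
  Sh-∷ʳ [] (y ∷ v') a b G =
    trans (Sh-∷ a [] y (v' ∷ʳ b) G)
    (trans (cong₂ _+_ (Sh-[]ˡ (y ∷ (v' ∷ʳ b)) (λ w → G (a ∷ w)))
             (trans (Sh-∷ʳ [] v' a b (λ w → G (y ∷ w))) (cong (_+ R) (Sh-[]ˡ (v' ∷ʳ b) (λ w → G (y ∷ (w ∷ʳ a)))))))
    (trans (swap₁₂ (G (a ∷ y ∷ (v' ∷ʳ b))) (G (y ∷ ((v' ∷ʳ b) ∷ʳ a))) R)
    (sym (cong₂ _+_ (Sh-[]ˡ (y ∷ (v' ∷ʳ b)) (λ w → G (w ∷ʳ a)))
            (trans (Sh-∷ a [] y v' (λ w → G (w ∷ʳ b))) (cong (_+ R) (Sh-[]ˡ (y ∷ v') (λ w → G (a ∷ (w ∷ʳ b))))))))))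
    where
    R = Sh (a ∷ []) v' (λ w → G (y ∷ (w ∷ʳ b)))
    swap₁₂ : ∀ p q r → p + (q + r) ≡ q + (p + r)
    swap₁₂ = solve-∀
  Sh-∷ʳ u@(x ∷ u') v@(y ∷ v') a b G =
    trans (Sh-∷ x (u' ∷ʳ a) y (v' ∷ʳ b) G)
    (trans (cong₂ _+_ (Sh-∷ʳ u' v a b (λ w → G (x ∷ w))) (Sh-∷ʳ u v' a b (λ w → G (y ∷ w))))
    (trans (interchange P Q R S')
    (sym (cong₂ _+_ (Sh-∷ x u' y (v' ∷ʳ b) (λ w → G (w ∷ʳ a))) (Sh-∷ x (u' ∷ʳ a) y v' (λ w → G (w ∷ʳ b)))))))
    where
    P = Sh u' (v ∷ʳ b) (λ w → G (x ∷ (w ∷ʳ a)))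
    Q = Sh (u' ∷ʳ a) v (λ w → G (x ∷ (w ∷ʳ b)))
    R = Sh u (v' ∷ʳ b) (λ w → G (y ∷ (w ∷ʳ a)))
    S' = Sh (u ∷ʳ a) v' (λ w → G (y ∷ (w ∷ʳ b)))
    interchange : ∀ p q r s → p + q + (r + s) ≡ p + r + (q + s)
    interchange = solve-∀

  ⊕-assoc : ∀ x y z → (x ⊕ y) ⊕ z ≋ x ⊕ (y ⊕ z)
  ⊕-assoc x y z = ≋-reflexive (LP.++-assoc x y z)

  ⊕-interchange : ∀ x y z t → (x ⊕ y) ⊕ (z ⊕ t) ≋ (x ⊕ z) ⊕ (y ⊕ t)
  ⊕-interchange x y z t = mk≋ λ G →
    trans (ev-++ G (x ⊕ y) (z ⊕ t)) (trans (cong₂ _+_ (ev-++ G x y) (ev-++ G z t))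
    (trans (interchange (ev G x) (ev G y) (ev G z) (ev G t))
    (sym (trans (ev-++ G (x ⊕ z) (y ⊕ t)) (cong₂ _+_ (ev-++ G x z) (ev-++ G y t))))))
    where
    interchange : ∀ p q r s → p + q + (r + s) ≡ p + r + (q + s)
    interchange = solve-∀

  sumFrom : ℕ → ℕ → (ℕ → Lin) → Lin
  sumFrom a zero f = 𝟘
  sumFrom a (suc m) f = f a ⊕ sumFrom (suc a) m f

  sumFrom-cong : ∀ a m {f g} → (∀ i → a ≤ i → i < a ℕ.+ m → f i ≋ g i) → sumFrom a m f ≋ sumFrom a m g
  sumFrom-cong a zero e = ≋-refl
  sumFrom-cong a (suc m) e = ⊕-cong (e a ℕP.≤-refl (ℕP.m<m+n a (s≤s z≤n)))
    (sumFrom-cong (suc a) m (λ i a<i i< → e i (ℕP.<⇒≤ a<i) (subst (i <_) (sym (ℕP.+-suc a m)) i<)))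

  sumFrom-cong′ : ∀ a m {f g} → (∀ i → f i ≋ g i) → sumFrom a m f ≋ sumFrom a m g
  sumFrom-cong′ a m e = sumFrom-cong a m (λ i _ _ → e i)

  sumFrom-zero : ∀ a m f → (∀ i → a ≤ i → i < a ℕ.+ m → f i ≋ 𝟘) → sumFrom a m f ≋ 𝟘
  sumFrom-zero a m f e = ≋-trans (sumFrom-cong a m e) (≋-reflexive (zeros a m))
    where
    zeros : ∀ a m → sumFrom a m (λ _ → 𝟘) ≡ 𝟘
    zeros a zero = refl
    zeros a (suc m) = zeros (suc a) m

  sumFrom-⊕ : ∀ a m f g → sumFrom a m (λ i → f i ⊕ g i) ≋ sumFrom a m f ⊕ sumFrom a m g
  sumFrom-⊕ a zero f g = ≋-refl
  sumFrom-⊕ a (suc m) f g = ≋-trans (⊕-congʳ (f a ⊕ g a) (sumFrom-⊕ (suc a) m f g))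
    (⊕-interchange (f a) (g a) (sumFrom (suc a) m f) (sumFrom (suc a) m g))

  sumFrom-scale : ∀ a m c f → sumFrom a m (λ i → scale c (f i)) ≋ scale c (sumFrom a m f)
  sumFrom-scale a zero c f = ≋-refl
  sumFrom-scale a (suc m) c f =
    ≋-trans (⊕-congʳ (scale c (f a)) (sumFrom-scale (suc a) m c f)) (≋-sym (scale-⊕ c (f a) (sumFrom (suc a) m f)))

  sumFrom-⧢ˡ : ∀ y a m f → sumFrom a m f ⧢ y ≋ sumFrom a m (λ i → f i ⧢ y)
  sumFrom-⧢ˡ y a zero f = ⧢-zeroˡ y
  sumFrom-⧢ˡ y a (suc m) f = ≋-trans (⧢-⊕ˡ (f a) (sumFrom (suc a) m f) y) (⊕-congʳ (f a ⧢ y) (sumFrom-⧢ˡ y (suc a) m f))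

  sumFrom-⧢ʳ : ∀ x a m f → x ⧢ sumFrom a m f ≋ sumFrom a m (λ i → x ⧢ f i)
  sumFrom-⧢ʳ x a zero f = ⧢-zeroʳ x
  sumFrom-⧢ʳ x a (suc m) f = ≋-trans (⧢-⊕ʳ x (f a) (sumFrom (suc a) m f)) (⊕-congʳ (x ⧢ f a) (sumFrom-⧢ʳ x (suc a) m f))

  sumFrom-·ʳ : ∀ x a m f → x · sumFrom a m f ≋ sumFrom a m (λ i → x · f i)
  sumFrom-·ʳ x a zero f = ·-zeroʳ x
  sumFrom-·ʳ x a (suc m) f = ≋-trans (·-⊕ʳ x (f a) (sumFrom (suc a) m f)) (⊕-congʳ (x · f a) (sumFrom-·ʳ x (suc a) m f))

  sumFrom-split : ∀ a m k f → sumFrom a (m ℕ.+ k) f ≋ sumFrom a m f ⊕ sumFrom (a ℕ.+ m) k f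
  sumFrom-split a zero k f = ≋-reflexive (cong (λ b → sumFrom b k f) (sym (ℕP.+-identityʳ a)))
  sumFrom-split a (suc m) k f =
    ≋-trans (⊕-congʳ (f a) (≋-trans (sumFrom-split (suc a) m k f)
              (≋-reflexive (cong (λ b → sumFrom (suc a) m f ⊕ sumFrom b k f) (sym (ℕP.+-suc a m))))))
            (≋-sym (⊕-assoc (f a) (sumFrom (suc a) m f) (sumFrom (a ℕ.+ suc m) k f)))

  sumFrom-last : ∀ a m f → sumFrom a (suc m) f ≋ sumFrom a m f ⊕ f (a ℕ.+ m)
  sumFrom-last a m f = ≋-trans (≋-reflexive (cong (λ k → sumFrom a k f) (ℕP.+-comm 1 m)))
    (≋-trans (sumFrom-split a m 1 f) (⊕-congʳ (sumFrom a m f) (⊕-identityʳ (f (a ℕ.+ m)))))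

  sumFrom-upTo : ∀ a n f → a ≤ n → sumFrom a (suc n ∸ a) f ≋ sumFrom a (n ∸ a) f ⊕ f n
  sumFrom-upTo a n f a≤n = ≋-trans (≋-reflexive (cong (λ k → sumFrom a k f) (ℕP.+-∸-assoc 1 a≤n)))
    (≋-trans (sumFrom-last a (n ∸ a) f) (≋-reflexive (cong (λ i → sumFrom a (n ∸ a) f ⊕ f i) (ℕP.m+[n∸m]≡n a≤n))))

  sumFrom-comm : ∀ a m b k (f : ℕ → ℕ → Lin) →
    sumFrom a m (λ i → sumFrom b k (f i)) ≋ sumFrom b k (λ l → sumFrom a m (λ i → f i l))
  sumFrom-comm a zero b k f = ≋-sym (sumFrom-zero b k _ (λ _ _ _ → ≋-refl))
  sumFrom-comm a (suc m) b k f = ≋-trans (⊕-congʳ (sumFrom b k (f a)) (sumFrom-comm (suc a) m b k f))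
    (≋-sym (sumFrom-⊕ b k (f a) (λ l → sumFrom (suc a) m (λ i → f i l))))

  Σ-applyUpTo : ∀ a (f : ℕ → Lin) m (h : ℕ → ℕ) k → (∀ i → h i ≡ k ℕ.+ i) →
    concatMap (λ i → f (a ℕ.+ i)) (applyUpTo h m) ≋ sumFrom (a ℕ.+ k) m f
  Σ-applyUpTo a f zero h k e = ≋-refl
  Σ-applyUpTo a f (suc m) h k e =
    ⊕-cong (≋-reflexive (cong (λ i → f (a ℕ.+ i)) (trans (e 0) (ℕP.+-identityʳ k))))
      (≋-trans (Σ-applyUpTo a f m (λ i → h (suc i)) (suc k) (λ i → trans (e (suc i)) (ℕP.+-suc k i)))
               (≋-reflexive (cong (λ b → sumFrom b m f) (ℕP.+-suc a k))))

  Σ-to-sumFrom : ∀ a b f → Σ[ a to b ] f ≋ sumFrom a (suc b ∸ a) f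
  Σ-to-sumFrom a b f = ≋-trans (Σ-applyUpTo a f (suc b ∸ a) (λ i → i) 0 (λ i → refl))
    (≋-reflexive (cong (λ c → sumFrom c (suc b ∸ a) f) (ℕP.+-identityʳ a)))

  sgn-+ : ∀ a b → sgn (a ℕ.+ b) ≡ sgn a * sgn b
  sgn-+ zero b = sym (*-identityˡ (sgn b))
  sgn-+ (suc a) b = trans (cong -_ (sgn-+ a b)) (neg-distribˡ-* (sgn a) (sgn b))

  sgn-sq : ∀ a → sgn a * sgn a ≡ 1ℤ
  sgn-sq zero = refl
  sgn-sq (suc a) = trans (neg-sq (sgn a)) (sgn-sq a)
    where
    neg-sq : ∀ x → (- x) * (- x) ≡ x * x
    neg-sq = solve-∀

  sgn-suc-* : ∀ a → sgn (suc a) * sgn a ≡ -1ℤ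
  sgn-suc-* a = trans (sym (neg-distribˡ-* (sgn a) (sgn a))) (cong -_ (sgn-sq a))

  scale-sgn-sq : ∀ a x → scale (sgn a) (scale (sgn a) x) ≋ x
  scale-sgn-sq a x = ≋-trans (scale-scale (sgn a) (sgn a) x) (≋-trans (scale-congˡ x (sgn-sq a)) (scale-1 x))

  telescope : ∀ a m (t : ℕ → Lin) →
    sumFrom a m (λ i → scale (sgn i) (t i ⊕ t (suc i))) ≋ scale (sgn a) (t a) ⊖ scale (sgn (a ℕ.+ m)) (t (a ℕ.+ m))
  telescope a zero t = mk≋ λ G →
    trans (sym (+-inverseʳ (ev G (scale (sgn a) (t a)))))
    (trans (cong (λ i → ev G (scale (sgn a) (t a)) - ev G (scale (sgn i) (t i))) (sym (ℕP.+-identityʳ a)))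
    (sym (ev-⊖ G (scale (sgn a) (t a)) (scale (sgn (a ℕ.+ 0)) (t (a ℕ.+ 0))))))
  telescope a (suc m) t = mk≋ λ G →
    begin
      ev G (scale (sgn a) (t a ⊕ t (suc a)) ⊕ sumFrom (suc a) m (λ i → scale (sgn i) (t i ⊕ t (suc i))))
    ≡⟨ trans (ev-++ G (scale (sgn a) (t a ⊕ t (suc a))) (sumFrom (suc a) m (λ i → scale (sgn i) (t i ⊕ t (suc i)))))
        (cong₂ _+_ (trans (ev-scale G (sgn a) (t a ⊕ t (suc a))) (cong (sgn a *_) (ev-++ G (t a) (t (suc a)))))
                   (at (telescope (suc a) m t) G)) ⟩
      sgn a * (ev G (t a) + ev G (t (suc a))) + ev G (scale (sgn (suc a)) (t (suc a)) ⊖ scale (sgn e) (t e))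
    ≡⟨ cong (sgn a * (ev G (t a) + ev G (t (suc a))) +_)
        (trans (ev-⊖ G (scale (sgn (suc a)) (t (suc a))) (scale (sgn e) (t e)))
               (cong₂ _-_ (ev-scale G (sgn (suc a)) (t (suc a))) (ev-scale G (sgn e) (t e)))) ⟩
      sgn a * (ev G (t a) + ev G (t (suc a))) + (- sgn a * ev G (t (suc a)) - sgn e * ev G (t e))
    ≡⟨ cancel (sgn a) (ev G (t a)) (ev G (t (suc a))) (sgn e * ev G (t e)) ⟩
      sgn a * ev G (t a) - sgn e * ev G (t e)
    ≡⟨ sym (trans (ev-⊖ G (scale (sgn a) (t a)) (scale (sgn e) (t e))) (cong₂ _-_ (ev-scale G (sgn a) (t a)) (ev-scale G (sgn e) (t e)))) ⟩
      ev G (scale (sgn a) (t a) ⊖ scale (sgn e) (t e))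
    ≡⟨ cong (λ i → ev G (scale (sgn a) (t a) ⊖ scale (sgn i) (t i))) (sym (ℕP.+-suc a m)) ⟩
      ev G (scale (sgn a) (t a) ⊖ scale (sgn (a ℕ.+ suc m)) (t (a ℕ.+ suc m)))
    ∎
    where
    open ≡-Reasoning
    e = suc a ℕ.+ m
    cancel : ∀ s p q r → s * (p + q) + (- s * q - r) ≡ s * p - r
    cancel = solve-∀

  telescope-zero : ∀ a m (t : ℕ → Lin) → t a ≋ 𝟘 → t (a ℕ.+ m) ≋ 𝟘 →
    sumFrom a m (λ i → scale (sgn i) (t i ⊕ t (suc i))) ≋ 𝟘
  telescope-zero a m t first last = ≋-trans (telescope a m t) (mk≋ λ G →
    trans (ev-⊖ G (scale (sgn a) (t a)) (scale (sgn (a ℕ.+ m)) (t (a ℕ.+ m))))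
          (cong₂ _-_ (at (scale-zero (sgn a) first) G) (at (scale-zero (sgn (a ℕ.+ m)) last) G)))

  ⊕₃-first : ∀ {x y z} → y ≋ 𝟘 → z ≋ 𝟘 → x ⊕ y ⊕ z ≋ x
  ⊕₃-first {x} y≋0 z≋0 = ≋-trans (⊕-cong (⊕-congʳ x y≋0) z≋0) (≋-trans (⊕-identityʳ (x ⊕ 𝟘)) (⊕-identityʳ x))

  ⊕₃-second : ∀ {x y z} → x ≋ 𝟘 → z ≋ 𝟘 → x ⊕ y ⊕ z ≋ y
  ⊕₃-second {y = y} x≋0 z≋0 = ≋-trans (⊕-cong (⊕-congˡ y x≋0) z≋0) (⊕-identityʳ y)

  ⊕₃-third : ∀ {x y z} → x ≋ 𝟘 → y ≋ 𝟘 → x ⊕ y ⊕ z ≋ z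
  ⊕₃-third {z = z} x≋0 y≋0 = ⊕-congˡ z (⊕-cong x≋0 y≋0)

  ⊕₃-none : ∀ {x y z} → x ≋ 𝟘 → y ≋ 𝟘 → z ≋ 𝟘 → x ⊕ y ⊕ z ≋ 𝟘
  ⊕₃-none x≋0 y≋0 z≋0 = ⊕-cong (⊕-cong x≋0 y≋0) z≋0

  ηw : ℕ → ℕ → Word
  ηw k l = applyUpTo (k ℕ.+_) (suc l ∸ k)

  δw : ℕ → ℕ → Word
  δw l k = reverse (ηw k l)

  η-word : ∀ k l → k ≤ suc l → η k l ≡ ⟪ ηw k l ⟫
  η-word k l p with k ℕ.≤? suc l
  ... | yes _ = refl
  ... | no np = ⊥-elim (np p)

  η-zero : ∀ k l → suc (suc l) ≤ k → η k l ≡ 𝟘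
  η-zero k l p with k ℕ.≤? suc l
  ... | yes q = ⊥-elim (ℕP.<⇒≱ p q)
  ... | no _ = refl

  δ-word : ∀ l k → k ≤ suc l → δ l k ≡ ⟪ δw l k ⟫
  δ-word l k p with k ℕ.≤? suc l
  ... | yes _ = refl
  ... | no np = ⊥-elim (np p)

  δ-zero : ∀ l k → suc (suc l) ≤ k → δ l k ≡ 𝟘
  δ-zero l k p with k ℕ.≤? suc l
  ... | yes q = ⊥-elim (ℕP.<⇒≱ p q)
  ... | no _ = refl

  ηw-∅ : ∀ l → ηw (suc l) l ≡ []
  ηw-∅ l = cong (applyUpTo (suc l ℕ.+_)) (ℕP.n∸n≡0 l)

  η-∅ : ∀ l → η (suc l) l ≡ ⟪ [] ⟫
  η-∅ l = trans (η-word (suc l) l ℕP.≤-refl) (cong ⟪_⟫ (ηw-∅ l))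

  δ-∅ : ∀ l → δ l (suc l) ≡ ⟪ [] ⟫
  δ-∅ l = trans (δ-word l (suc l) ℕP.≤-refl) (cong (λ w → ⟪ reverse w ⟫) (ηw-∅ l))

  applyUpTo-cong : ∀ {f g : ℕ → ℕ} m → (∀ i → i < m → f i ≡ g i) → applyUpTo f m ≡ applyUpTo g m
  applyUpTo-cong zero e = refl
  applyUpTo-cong (suc m) e = cong₂ _∷_ (e 0 (s≤s z≤n)) (applyUpTo-cong m (λ i p → e (suc i) (s≤s p)))

  ηw-∷ : ∀ k l → k ≤ l → ηw k l ≡ k ∷ ηw (suc k) l
  ηw-∷ k l p = trans (cong (applyUpTo (k ℕ.+_)) (ℕP.+-∸-assoc 1 p))
    (cong₂ _∷_ (ℕP.+-identityʳ k) (applyUpTo-cong (l ∸ k) (λ i _ → ℕP.+-suc k i)))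

  ηw-∷ʳ : ∀ k l → k ≤ suc l → ηw k (suc l) ≡ ηw k l ∷ʳ suc l
  ηw-∷ʳ k l p = trans (cong (applyUpTo (k ℕ.+_)) (ℕP.+-∸-assoc 1 p))
    (trans (sym (LP.applyUpTo-∷ʳ (k ℕ.+_) (suc l ∸ k))) (cong (ηw k l ∷ʳ_) (ℕP.m+[n∸m]≡n p)))

  δw-∷ : ∀ l k → k ≤ suc l → δw (suc l) k ≡ suc l ∷ δw l k
  δw-∷ l k p = trans (cong reverse (ηw-∷ʳ k l p)) (LP.reverse-++ (ηw k l) (suc l ∷ []))

  η-∷ : ∀ k l → k ≤ l → η k l ≋ ltr k · η (suc k) l
  η-∷ k l p = ≋-trans (≋-reflexive (trans (η-word k l (ℕP.m≤n⇒m≤1+n p)) (cong ⟪_⟫ (ηw-∷ k l p))))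
    (≋-trans (≋-sym (ltr-·-⟪⟫ k (ηw (suc k) l))) (·-congʳ (ltr k) (≋-reflexive (sym (η-word (suc k) l (s≤s p))))))

  δ-∷ : ∀ l k → k ≤ suc l → δ (suc l) k ≋ ltr (suc l) · δ l k
  δ-∷ l k p = ≋-trans (≋-reflexive (trans (δ-word (suc l) k (ℕP.m≤n⇒m≤1+n p)) (cong ⟪_⟫ (δw-∷ l k p))))
    (≋-trans (≋-sym (ltr-·-⟪⟫ (suc l) (δw l k))) (·-congʳ (ltr (suc l)) (≋-reflexive (sym (δ-word l k p)))))

  η-∷ʳ : ∀ k l → k ≤ suc l → η k (suc l) ≡ ⟪ ηw k l ∷ʳ suc l ⟫
  η-∷ʳ k l p = trans (η-word k (suc l) (ℕP.m≤n⇒m≤1+n p)) (cong ⟪_⟫ (ηw-∷ʳ k l p))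

  δ-single : ∀ l → δ (suc l) (suc l) ≋ ltr (suc l)
  δ-single l = ≋-trans (δ-∷ l (suc l) ℕP.≤-refl)
    (≋-trans (·-congʳ (ltr (suc l)) (≋-reflexive (δ-∅ l))) (ltr-·-⟪⟫ (suc l) []))

  δη-word : ∀ k k' → δ (suc (suc k)) (suc k) · η 1 k' ≋ ⟪ suc (suc k) ∷ suc k ∷ applyUpTo suc k' ⟫
  δη-word k k' = ≋-trans (·-cong (≋-trans (δ-∷ (suc k) (suc k) (ℕP.n≤1+n _))
                                (≋-trans (·-congʳ (ltr (suc (suc k))) (δ-single k)) (ltr-·-⟪⟫ (suc (suc k)) (suc k ∷ []))))
                                (≋-reflexive (η-word 1 k' (s≤s z≤n))))
    (⟪⟫-· (suc (suc k) ∷ suc k ∷ []) (ηw 1 k'))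

  ⧢-η-∅ : ∀ x n → x ⧢ η (suc n) n ≋ x
  ⧢-η-∅ x n = ≋-trans (⧢-congʳ x (≋-reflexive (η-∅ n))) (⧢-∅ x)

  ⧢-η-zero : ∀ x n → x ⧢ η (suc (suc n)) n ≋ 𝟘
  ⧢-η-zero x n = ≋-trans (⧢-congʳ x (≋-reflexive (η-zero (suc (suc n)) n ℕP.≤-refl))) (⧢-zeroʳ x)

  δ-zero-⧢ : ∀ l k y → suc (suc l) ≤ k → δ l k ⧢ y ≋ 𝟘
  δ-zero-⧢ l k y p = ⧢-congˡ y (≋-reflexive (δ-zero l k p))

  ⧢-δ-zero : ∀ x l k → suc (suc l) ≤ k → x ⧢ δ l k ≋ 𝟘
  ⧢-δ-zero x l k p = ≋-trans (⧢-congʳ x (≋-reflexive (δ-zero l k p))) (⧢-zeroʳ x)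

  ⧢-δ-∅ : ∀ x l → x ⧢ δ l (suc l) ≋ x
  ⧢-δ-∅ x l = ≋-trans (⧢-congʳ x (≋-reflexive (δ-∅ l))) (⧢-∅ x)

  ηSum : (ℕ → Lin) → ℕ → ℕ → Lin
  ηSum F n m = sumFrom m (suc n ∸ m) (λ i → scale (sgn i) (F i ⧢ η (suc i) n))

  ηSum-⧢ˡ : ∀ x F n m → ηSum (λ i → x ⧢ F i) n m ≋ x ⧢ ηSum F n m
  ηSum-⧢ˡ x F n m =
    ≋-trans (sumFrom-cong′ m (suc n ∸ m) (λ i → ≋-trans (scale-cong (sgn i) (⧢-assoc x (F i) (η (suc i) n)))
              (≋-sym (⧢-scaleʳ (sgn i) x (F i ⧢ η (suc i) n)))))
    (≋-sym (sumFrom-⧢ʳ x m (suc n ∸ m) (λ i → scale (sgn i) (F i ⧢ η (suc i) n))))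

  δη-sum : ℕ → ℕ → ℕ → Lin
  δη-sum k = ηSum (λ i → δ i k)

  sumFrom-index-≤ : ∀ m n i → m ≤ suc n → i < m ℕ.+ (suc n ∸ m) → i ≤ n
  sumFrom-index-≤ m n i m≤ i< = ℕP.≤-pred (subst (i <_) (ℕP.m+[n∸m]≡n m≤) i<)

  δη-sum-above : ∀ k n m → suc (suc n) ≤ k → δη-sum k n m ≋ 𝟘
  δη-sum-above k n m p = sumFrom-zero m (suc n ∸ m) _ (λ i m≤i i< → scale-zero (sgn i)
    (δ-zero-⧢ i k (η (suc i) n) (ℕP.≤-trans (s≤s (s≤s (i≤n i m≤i i<))) p)))
    where
    i≤n : ∀ i → m ≤ i → i < m ℕ.+ (suc n ∸ m) → i ≤ n
    i≤n i m≤i i< with m ℕ.≤? suc n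
    ... | yes m≤ = sumFrom-index-≤ m n i m≤ i<
    ... | no m≰ = ⊥-elim (ℕP.<⇒≱ (subst (i <_) (trans (cong (m ℕ.+_) (ℕP.m≤n⇒m∸n≡0 (ℕP.<⇒≤ (ℕP.≰⇒> m≰))))
                                                       (ℕP.+-identityʳ m)) i<) m≤i)

  δη-sum-top : ∀ n m → 1 ≤ m → m ≤ n → δη-sum (suc n) n m ≋ scale (sgn n) ⟪ [] ⟫
  δη-sum-top n m _ m≤n =
    ≋-trans (sumFrom-upTo m n f m≤n)
    (≋-trans (⊕-congˡ (f n) (sumFrom-zero m (n ∸ m) f (λ i _ i< →
               scale-zero (sgn i) (δ-zero-⧢ i (suc n) (η (suc i) n) (s≤s (subst (i <_) (ℕP.m+[n∸m]≡n m≤n) i<))))))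
    (scale-cong (sgn n) (≋-trans (⧢-δ-∅ₗ n) (≋-reflexive (η-∅ n)))))
    where
    f : ℕ → Lin
    f i = scale (sgn i) (δ i (suc n) ⧢ η (suc i) n)
    ⧢-δ-∅ₗ : ∀ n → δ n (suc n) ⧢ η (suc n) n ≋ η (suc n) n
    ⧢-δ-∅ₗ n = ≋-trans (⧢-congˡ (η (suc n) n) (≋-reflexive (δ-∅ n))) (∅-⧢ (η (suc n) n))

  -- By the first-letter recursion, δ_{l,k} ⧢ η_{l+1,n} = l (δ_{l−1,k} ⧢ η_{l+1,n}) + (l+1) (δ_{l,k} ⧢ η_{l+2,n}),
  -- so the alternating sum telescopes.
  δη-step : ℕ → ℕ → ℕ → Lin
  δη-step k n zero = 𝟘
  δη-step k n (suc i) = ltr (suc i) · (δ i k ⧢ η (suc (suc i)) n)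

  δη-split : ∀ k' n i → suc k' ≤ n → suc i ≤ n →
    δ (suc i) (suc k') ⧢ η (suc (suc i)) n ≋ δη-step (suc k') n (suc i) ⊕ δη-step (suc k') n (suc (suc i))
  δη-split k' n i k≤n i<n with ℕP.<-cmp (suc i) k'
  ... | tri< i<k _ _ =
    ≋-trans (δ-zero-⧢ (suc i) k (η (suc (suc i)) n) (s≤s i<k))
    (≋-sym (⊕-cong (≋-trans (·-congʳ (ltr (suc i)) (δ-zero-⧢ i k (η (suc (suc i)) n) (s≤s (ℕP.<⇒≤ i<k)))) (·-zeroʳ (ltr (suc i))))
                   (≋-trans (·-congʳ (ltr (suc (suc i))) (δ-zero-⧢ (suc i) k (η (suc (suc (suc i))) n) (s≤s i<k)))
                            (·-zeroʳ (ltr (suc (suc i)))))))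
    where k = suc k'
  ... | tri≈ _ refl _ =
    ≋-trans (⧢-congˡ (η k n) (≋-reflexive (δ-∅ (suc i)))) (≋-trans (∅-⧢ (η k n)) (≋-trans (η-∷ k n k≤n)
    (≋-sym (⊕-cong (≋-trans (·-congʳ (ltr (suc i)) (δ-zero-⧢ i k (η k n) ℕP.≤-refl)) (·-zeroʳ (ltr (suc i))))
                   (·-congʳ (ltr k) (≋-trans (⧢-congˡ (η (suc k) n) (≋-reflexive (δ-∅ (suc i)))) (∅-⧢ (η (suc k) n))))))))
    where k = suc (suc i)
  ... | tri> _ _ k≤i with ℕP.m≤n⇒m<n∨m≡n i<n
  ...   | inj₁ 1+i<n =
    ≋-trans (⧢-cong (δ-∷ i k k≤i) (η-∷ (suc (suc i)) n 1+i<n))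
    (≋-trans (ltr-·-⧢-ltr-· (suc i) (δ i k) (suc (suc i)) (η (suc (suc (suc i))) n))
    (⊕-cong (·-congʳ (ltr (suc i)) (⧢-congʳ (δ i k) (≋-sym (η-∷ (suc (suc i)) n 1+i<n))))
            (·-congʳ (ltr (suc (suc i))) (⧢-congˡ (η (suc (suc (suc i))) n) (≋-sym (δ-∷ i k k≤i))))))
    where k = suc k'
  ...   | inj₂ refl =
    ≋-trans (⧢-η-∅ (δ (suc i) k) (suc i)) (≋-trans (δ-∷ i k k≤i)
    (≋-sym (≋-trans (⊕-cong (·-congʳ (ltr (suc i)) (⧢-η-∅ (δ i k) (suc i)))
                            (≋-trans (·-congʳ (ltr (suc (suc i))) (⧢-η-zero (δ (suc i) k) (suc i))) (·-zeroʳ (ltr (suc (suc i))))))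
            (⊕-identityʳ (ltr (suc i) · δ i k)))))
    where k = suc k'

  δη-sum-vanishes : ∀ k' n m → 1 ≤ m → m ≤ k' → suc k' ≤ n → δη-sum (suc k') n m ≋ 𝟘
  δη-sum-vanishes k' n (suc m') _ m≤k k<n =
    ≋-trans (sumFrom-cong m len (λ { (suc i) _ i< → scale-cong (sgn (suc i))
                (δη-split k' n i k<n (ℕP.≤-pred (subst (suc i <_) m+len i<))) }))
    (telescope-zero m len (δη-step (suc k') n) first last)
    where
    m = suc m'
    len = suc n ∸ m
    m+len : m ℕ.+ len ≡ suc n
    m+len = ℕP.m+[n∸m]≡n (ℕP.≤-trans m≤k (ℕP.≤-trans (ℕP.n≤1+n k') (ℕP.m≤n⇒m≤1+n k<n)))
    first : δη-step (suc k') n m ≋ 𝟘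
    first = ≋-trans (·-congʳ (ltr m) (δ-zero-⧢ m' (suc k') (η (suc m) n) (s≤s m≤k))) (·-zeroʳ (ltr m))
    last : δη-step (suc k') n (m ℕ.+ len) ≋ 𝟘
    last = subst (λ z → δη-step (suc k') n z ≋ 𝟘) (sym m+len)
      (≋-trans (·-congʳ (ltr (suc n)) (⧢-η-zero (δ n (suc k')) n)) (·-zeroʳ (ltr (suc n))))

  ηSum-leading-term : ∀ (F V : ℕ → Lin) c n i → F i ≋ ltr c · V i ⊕ ltr i · F (i ∸ 1) → i ≤ n →
    F i ⧢ η (suc i) n ≋
      ltr c · (V i ⧢ η (suc i) n) ⊕ (ltr i · (F (i ∸ 1) ⧢ η (suc i) n) ⊕ ltr (suc i) · (F i ⧢ η (suc (suc i)) n))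
  ηSum-leading-term F V c n i hF i≤n with ℕP.m≤n⇒m<n∨m≡n i≤n
  ... | inj₁ i<n =
    begin
      F i ⧢ η (suc i) n
    ≋⟨ ⧢-cong hF η-head ⟩
      (ltr c · V i ⊕ ltr i · F') ⧢ (ltr b · Y)
    ≋⟨ ≋-trans (⧢-⊕ˡ (ltr c · V i) (ltr i · F') (ltr b · Y)) (⊕-cong (ltr-·-⧢-ltr-· c (V i) b Y) (ltr-·-⧢-ltr-· i F' b Y)) ⟩
      (A ⊕ B) ⊕ (C ⊕ D)
    ≋⟨ ≋-trans (⊕-interchange A B C D) (⊕-assoc A C (B ⊕ D)) ⟩
      A ⊕ (C ⊕ (B ⊕ D))
    ≋⟨ ⊕-cong (·-congʳ (ltr c) (⧢-congʳ (V i) (≋-sym η-head))) (⊕-cong (·-congʳ (ltr i) (⧢-congʳ F' (≋-sym η-head)))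
         (≋-sym (≋-trans (·-congʳ (ltr b) (≋-trans (⧢-congˡ Y hF) (⧢-⊕ˡ (ltr c · V i) (ltr i · F') Y)))
                         (·-⊕ʳ (ltr b) ((ltr c · V i) ⧢ Y) ((ltr i · F') ⧢ Y))))) ⟩
      ltr c · (V i ⧢ η (suc i) n) ⊕ (ltr i · (F' ⧢ η (suc i) n) ⊕ ltr b · (F i ⧢ Y))
    ∎
    where
    open ≋-Reasoning
    F' = F (i ∸ 1)
    b = suc i
    Y = η (suc (suc i)) n
    η-head : η (suc i) n ≋ ltr b · Y
    η-head = η-∷ (suc i) n i<n
    A = ltr c · (V i ⧢ (ltr b · Y))
    B = ltr b · ((ltr c · V i) ⧢ Y)
    C = ltr i · (F' ⧢ (ltr b · Y))
    D = ltr b · ((ltr i · F') ⧢ Y)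
  ... | inj₂ refl =
    begin
      F i ⧢ η (suc i) i
    ≋⟨ ≋-trans (⧢-η-∅ (F i) i) hF ⟩
      ltr c · V i ⊕ ltr i · F'
    ≋⟨ ⊕-cong (·-congʳ (ltr c) (≋-sym (⧢-η-∅ (V i) i)))
              (≋-sym (≋-trans (⊕-cong (·-congʳ (ltr i) (⧢-η-∅ F' i))
                                      (≋-trans (·-congʳ (ltr (suc i)) (⧢-η-zero (F i) i)) (·-zeroʳ (ltr (suc i)))))
                              (⊕-identityʳ (ltr i · F')))) ⟩
      ltr c · (V i ⧢ η (suc i) i) ⊕ (ltr i · (F' ⧢ η (suc i) i) ⊕ ltr (suc i) · (F i ⧢ η (suc (suc i)) i))
    ∎
    where
    open ≋-Reasoning
    F' = F (i ∸ 1)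

  ηSum-leading : ∀ (F V : ℕ → Lin) c n m → 1 ≤ m → m ≤ suc n →
    (∀ i → m ≤ i → i ≤ n → F i ≋ ltr c · V i ⊕ ltr i · F (i ∸ 1)) → F (m ∸ 1) ≋ 𝟘 →
    ηSum F n m ≋ ltr c · ηSum V n m
  ηSum-leading F V c n m _ m≤1+n hF F-before =
    begin
      sumFrom m len (λ i → scale (sgn i) (F i ⧢ η (suc i) n))
    ≋⟨ sumFrom-cong m len (λ i m≤i i< → ≋-trans
          (scale-cong (sgn i) (ηSum-leading-term F V c n i (hF i m≤i (i≤n i i<)) (i≤n i i<)))
          (scale-⊕ (sgn i) (g i) (t i ⊕ t (suc i)))) ⟩
      sumFrom m len (λ i → scale (sgn i) (g i) ⊕ scale (sgn i) (t i ⊕ t (suc i)))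
    ≋⟨ sumFrom-⊕ m len (λ i → scale (sgn i) (g i)) (λ i → scale (sgn i) (t i ⊕ t (suc i))) ⟩
      sumFrom m len (λ i → scale (sgn i) (g i)) ⊕ sumFrom m len (λ i → scale (sgn i) (t i ⊕ t (suc i)))
    ≋⟨ ≋-trans (⊕-congʳ (sumFrom m len (λ i → scale (sgn i) (g i))) (telescope-zero m len t first last))
               (⊕-identityʳ (sumFrom m len (λ i → scale (sgn i) (g i)))) ⟩
      sumFrom m len (λ i → scale (sgn i) (ltr c · (V i ⧢ η (suc i) n)))
    ≋⟨ sumFrom-cong′ m len (λ i → ≋-sym (·-scaleʳ (sgn i) (ltr c) (V i ⧢ η (suc i) n))) ⟩
      sumFrom m len (λ i → ltr c · scale (sgn i) (V i ⧢ η (suc i) n))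
    ≋⟨ ≋-sym (sumFrom-·ʳ (ltr c) m len (λ i → scale (sgn i) (V i ⧢ η (suc i) n))) ⟩
      ltr c · sumFrom m len (λ i → scale (sgn i) (V i ⧢ η (suc i) n))
    ∎
    where
    open ≋-Reasoning
    len = suc n ∸ m
    g t : ℕ → Lin
    g i = ltr c · (V i ⧢ η (suc i) n)
    t i = ltr i · (F (i ∸ 1) ⧢ η (suc i) n)
    m+len : m ℕ.+ len ≡ suc n
    m+len = ℕP.m+[n∸m]≡n m≤1+n
    i≤n : ∀ i → i < m ℕ.+ len → i ≤ n
    i≤n i = sumFrom-index-≤ m n i m≤1+n
    first : t m ≋ 𝟘
    first = ≋-trans (·-congʳ (ltr m) (⧢-congˡ (η (suc m) n) F-before)) (·-zeroʳ (ltr m))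
    last : t (m ℕ.+ len) ≋ 𝟘
    last = subst (λ z → t z ≋ 𝟘) (sym m+len)
      (≋-trans (·-congʳ (ltr (suc n)) (⧢-η-zero (F n) n)) (·-zeroʳ (ltr (suc n))))

  strip : ℕ → Lin → Lin
  strip j = concatMap (dropLastIf j)

  χ : ℕ → ℕ → ℤ
  χ j a with a ℕ.≟ j
  ... | yes _ = 1ℤ
  ... | no _ = 0ℤ

  χ-≡ : ∀ j → χ j j ≡ 1ℤ
  χ-≡ j with j ℕ.≟ j
  ... | yes _ = refl
  ... | no j≢j = ⊥-elim (j≢j refl)

  χ-≢ : ∀ j a → a ≢ j → χ j a ≡ 0ℤ
  χ-≢ j a a≢j with a ℕ.≟ j
  ... | yes a≡j = ⊥-elim (a≢j a≡j)
  ... | no _ = refl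

  scale-χ-≡ : ∀ j x → scale (χ j j) x ≋ x
  scale-χ-≡ j x = ≋-trans (scale-congˡ x (χ-≡ j)) (scale-1 x)

  scale-χ-≢ : ∀ {j a} x → a ≢ j → scale (χ j a) x ≋ 𝟘
  scale-χ-≢ {j} {a} x a≢j = mk≋ λ G →
    trans (ev-scale G (χ j a) x) (trans (cong (_* ev G x) (χ-≢ j a a≢j)) (*-zeroˡ (ev G x)))

  lastIs : ℕ → (Word → ℤ) → Word → ℤ
  lastIs j G u with reverse u
  ... | [] = 0ℤ
  ... | a ∷ r = χ j a * G (reverse r)

  lastIs-∷ʳ : ∀ j G w a → lastIs j G (w ∷ʳ a) ≡ χ j a * G w
  lastIs-∷ʳ j G w a rewrite LP.reverse-++ w (a ∷ []) | LP.reverse-involutive w = refl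

  lastIs-cong : ∀ j {G G'} → (∀ w → G w ≡ G' w) → ∀ u → lastIs j G u ≡ lastIs j G' u
  lastIs-cong j e u with reverse u
  ... | [] = refl
  ... | a ∷ r = cong (χ j a *_) (e (reverse r))

  ev-strip : ∀ G j x → ev G (strip j x) ≡ ev (lastIs j G) x
  ev-strip G j x = ev-concatMap G (lastIs j G) (dropLastIf j) x dropLast
    where
    dropLast : ∀ c u → ev G (dropLastIf j (c , u)) ≡ c * lastIs j G u
    dropLast c u with reverse u
    ... | [] = sym (*-zeroʳ c)
    ... | a ∷ r with a ℕ.≟ j
    ...   | yes _ = trans (+-identityʳ _) (cong (c *_) (sym (*-identityˡ _)))
    ...   | no _ = sym (trans (cong (c *_) (*-zeroˡ (G (reverse r)))) (*-zeroʳ c))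

  strip-cong : ∀ j {x y} → x ≋ y → strip j x ≋ strip j y
  strip-cong j {x} {y} e = mk≋ λ G → trans (ev-strip G j x) (trans (at e (lastIs j G)) (sym (ev-strip G j y)))

  strip-⊕ : ∀ j x y → strip j (x ⊕ y) ≋ strip j x ⊕ strip j y
  strip-⊕ j x y = ≋-reflexive (LP.concatMap-++ (dropLastIf j) x y)

  strip-scale : ∀ j c x → strip j (scale c x) ≋ scale c (strip j x)
  strip-scale j c x = mk≋ λ G → trans (ev-strip G j (scale c x)) (trans (ev-scale _ c x)
    (trans (cong (c *_) (sym (ev-strip G j x))) (sym (ev-scale G c (strip j x)))))

  strip-⊖ : ∀ j x y → strip j (x ⊖ y) ≋ strip j x ⊖ strip j y
  strip-⊖ j x y = ≋-trans (strip-⊕ j x (scale -1ℤ y)) (⊕-congʳ (strip j x) (strip-scale j -1ℤ y))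

  strip-sumFrom : ∀ j a m f → strip j (sumFrom a m f) ≋ sumFrom a m (λ i → strip j (f i))
  strip-sumFrom j a zero f = ≋-refl
  strip-sumFrom j a (suc m) f =
    ≋-trans (strip-⊕ j (f a) (sumFrom (suc a) m f)) (⊕-congʳ (strip j (f a)) (strip-sumFrom j (suc a) m f))

  strip-⟪∷ʳ⟫ : ∀ j w a → strip j ⟪ w ∷ʳ a ⟫ ≋ scale (χ j a) ⟪ w ⟫
  strip-⟪∷ʳ⟫ j w a = mk≋ λ G → trans (ev-strip G j ⟪ w ∷ʳ a ⟫) (trans (ev-⟪⟫ (lastIs j G) (w ∷ʳ a))
    (trans (lastIs-∷ʳ j G w a) (sym (trans (ev-scale G (χ j a) ⟪ w ⟫) (cong (χ j a *_) (ev-⟪⟫ G w))))))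

  Sh-lastIs : ∀ u v b j G → Sh u (v ∷ʳ b) (lastIs j G) ≡ lastIs j (λ t → Sh t (v ∷ʳ b) G) u + χ j b * Sh u v G
  Sh-lastIs u v b j G with initLast u
  ... | [] = trans (Sh-[]ˡ (v ∷ʳ b) (lastIs j G)) (trans (lastIs-∷ʳ j G v b)
               (sym (trans (+-identityˡ _) (cong (χ j b *_) (Sh-[]ˡ v G)))))
  ... | u' ∷ʳ′ a = trans (Sh-∷ʳ u' v a b (lastIs j G))
       (trans (cong₂ _+_ (trans (Sh-cong u' (v ∷ʳ b) (λ w → lastIs-∷ʳ j G w a)) (Sh-* u' (v ∷ʳ b) (χ j a) G))
                         (trans (Sh-cong (u' ∷ʳ a) v (λ w → lastIs-∷ʳ j G w b)) (Sh-* (u' ∷ʳ a) v (χ j b) G)))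
              (cong (_+ χ j b * Sh (u' ∷ʳ a) v G) (sym (lastIs-∷ʳ j (λ t → Sh t (v ∷ʳ b) G) u' a))))

  strip-⧢-∷ʳ : ∀ j x v b → strip j (x ⧢ ⟪ v ∷ʳ b ⟫) ≋ strip j x ⧢ ⟪ v ∷ʳ b ⟫ ⊕ scale (χ j b) (x ⧢ ⟪ v ⟫)
  strip-⧢-∷ʳ j x v b = mk≋ λ G →
    begin
      ev G (strip j (x ⧢ ⟪ v ∷ʳ b ⟫))
    ≡⟨ trans (ev-strip G j (x ⧢ ⟪ v ∷ʳ b ⟫)) (ev-⧢ (lastIs j G) x ⟪ v ∷ʳ b ⟫) ⟩
      ev (λ u → ev (λ v' → Sh u v' (lastIs j G)) ⟪ v ∷ʳ b ⟫) x
    ≡⟨ ev-cong x (λ u → trans (ev-⟪⟫ (λ v' → Sh u v' (lastIs j G)) (v ∷ʳ b)) (Sh-lastIs u v b j G)) ⟩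
      ev (λ u → lastIs j (λ t → Sh t (v ∷ʳ b) G) u + χ j b * Sh u v G) x
    ≡⟨ ev-+ (lastIs j (λ t → Sh t (v ∷ʳ b) G)) (λ u → χ j b * Sh u v G) x ⟩
      ev (lastIs j (λ t → Sh t (v ∷ʳ b) G)) x + ev (λ u → χ j b * Sh u v G) x
    ≡⟨ cong₂ _+_ (trans (ev-cong x (lastIs-cong j (λ t → sym (ev-⟪⟫ (λ v' → Sh t v' G) (v ∷ʳ b)))))
                        (trans (sym (ev-strip (λ u → ev (λ v' → Sh u v' G) ⟪ v ∷ʳ b ⟫) j x))
                               (sym (ev-⧢ G (strip j x) ⟪ v ∷ʳ b ⟫))))
                 (trans (ev-* (χ j b) (λ u → Sh u v G) x)
                        (cong (χ j b *_) (trans (ev-cong x (λ u → sym (ev-⟪⟫ (λ v' → Sh u v' G) v)))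
                                                (sym (ev-⧢ G x ⟪ v ⟫))))) ⟩
      ev G (strip j x ⧢ ⟪ v ∷ʳ b ⟫) + χ j b * ev G (x ⧢ ⟪ v ⟫)
    ≡⟨ sym (trans (ev-++ G (strip j x ⧢ ⟪ v ∷ʳ b ⟫) (scale (χ j b) (x ⧢ ⟪ v ⟫)))
                  (cong (ev G (strip j x ⧢ ⟪ v ∷ʳ b ⟫) +_) (ev-scale G (χ j b) (x ⧢ ⟪ v ⟫)))) ⟩
      ev G (strip j x ⧢ ⟪ v ∷ʳ b ⟫ ⊕ scale (χ j b) (x ⧢ ⟪ v ⟫))
    ∎
    where open ≡-Reasoning

  strip-⧢-η : ∀ j x i n → suc i ≤ n → strip j (x ⧢ η (suc i) n) ≋ strip j x ⧢ η (suc i) n ⊕ scale (χ j n) (x ⧢ η (suc i) (n ∸ 1))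
  strip-⧢-η j x i (suc n') (s≤s i≤n') =
    ≋-trans (strip-cong j (⧢-congʳ x (≋-reflexive (η-∷ʳ (suc i) n' (s≤s i≤n')))))
    (≋-trans (strip-⧢-∷ʳ j x (ηw (suc i) n') (suc n'))
    (⊕-cong (⧢-congʳ (strip j x) (≋-reflexive (sym (η-∷ʳ (suc i) n' (s≤s i≤n')))))
            (scale-cong (χ j (suc n')) (⧢-congʳ x (≋-reflexive (sym (η-word (suc i) n' (s≤s i≤n'))))))))

  strip-⧢-η-≢ : ∀ j x i n → i ≤ n → j ≢ n → strip j (x ⧢ η (suc i) n) ≋ strip j x ⧢ η (suc i) n
  strip-⧢-η-≢ j x i n i≤n j≢n with ℕP.m≤n⇒m<n∨m≡n i≤n
  ... | inj₁ i<n = ≋-trans (strip-⧢-η j x i n i<n)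
          (≋-trans (⊕-congʳ (strip j x ⧢ η (suc i) n) (scale-χ-≢ (x ⧢ η (suc i) (n ∸ 1)) (λ e → j≢n (sym e))))
                   (⊕-identityʳ (strip j x ⧢ η (suc i) n)))
  ... | inj₂ refl = ≋-trans (strip-cong j (⧢-η-∅ x i)) (≋-sym (⧢-η-∅ (strip j x) i))

  rank : ℕ → Word → ℕ
  rank a w = length (filter (λ b → b <? a) w)

  rank-∷-< : ∀ {x} a w → x < a → rank a (x ∷ w) ≡ suc (rank a w)
  rank-∷-< a w x<a = cong length (LP.filter-accept (λ b → b <? a) x<a)

  rank-∷-≮ : ∀ {x} a w → ¬ x < a → rank a (x ∷ w) ≡ rank a w
  rank-∷-≮ a w x≮a = cong length (LP.filter-reject (λ b → b <? a) x≮a)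

  interval-suc : ∀ t m → applyUpTo (λ x → t ℕ.+ suc x) m ≡ applyUpTo (suc t ℕ.+_) m
  interval-suc t m = applyUpTo-cong m (λ i _ → ℕP.+-suc t i)

  rank-interval-below : ∀ t m a → a ≤ t → rank a (applyUpTo (t ℕ.+_) m) ≡ 0
  rank-interval-below t zero a a≤t = refl
  rank-interval-below t (suc m) a a≤t =
    trans (rank-∷-≮ a (applyUpTo (λ x → t ℕ.+ suc x) m) (λ t<a → ℕP.<⇒≱ t<a (ℕP.≤-trans a≤t (ℕP.m≤m+n t 0))))
    (trans (cong (rank a) (interval-suc t m)) (rank-interval-below (suc t) m a (ℕP.m≤n⇒m≤1+n a≤t)))

  rank-interval-above : ∀ t m a → t ℕ.+ m ≤ a → rank a (applyUpTo (t ℕ.+_) m) ≡ m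
  rank-interval-above t zero a _ = refl
  rank-interval-above t (suc m) a t+m<a =
    trans (rank-∷-< a (applyUpTo (λ x → t ℕ.+ suc x) m) (ℕP.<-≤-trans (ℕP.+-monoʳ-< t (s≤s z≤n)) t+m<a))
    (cong suc (trans (cong (rank a) (interval-suc t m))
                     (rank-interval-above (suc t) m a (subst (_≤ a) (ℕP.+-suc t m) t+m<a))))

  rank-interval-inside : ∀ t m k → k ≤ m → rank (t ℕ.+ k) (applyUpTo (t ℕ.+_) m) ≡ k
  rank-interval-inside t m zero _ = rank-interval-below t m (t ℕ.+ 0) (ℕP.≤-reflexive (ℕP.+-identityʳ t))
  rank-interval-inside t (suc m) (suc k) (s≤s k≤m) =
    trans (rank-∷-< (t ℕ.+ suc k) (applyUpTo (λ x → t ℕ.+ suc x) m) (ℕP.+-monoʳ-< t (s≤s z≤n)))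
    (cong suc (trans (cong (rank (t ℕ.+ suc k)) (interval-suc t m))
       (trans (cong (λ a → rank a (applyUpTo (suc t ℕ.+_) m)) (ℕP.+-suc t k)) (rank-interval-inside (suc t) m k k≤m))))

  st-interval : ∀ t m → st (applyUpTo (t ℕ.+_) m) ≡ applyUpTo suc m
  st-interval t m = trans (LP.map-applyUpTo (t ℕ.+_) _ m)
    (applyUpTo-cong m (λ k k<m → cong suc (rank-interval-inside t m k (ℕP.<⇒≤ k<m))))

  st-single : ∀ n → st (n ∷ []) ≡ 1 ∷ []
  st-single n = cong (λ r → suc r ∷ []) (rank-∷-≮ n [] (ℕP.<-irrefl refl))

  st-∷-interval : ∀ q m → m < q → st (q ∷ applyUpTo suc m) ≡ suc m ∷ applyUpTo suc m
  st-∷-interval q m m<q = cong₂ _∷_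
    (cong suc (trans (rank-∷-≮ q A (ℕP.<-irrefl refl)) (rank-interval-above 1 m q m<q)))
    (trans (LP.map-applyUpTo suc _ m) (applyUpTo-cong m (λ k k<m → cong suc
      (trans (rank-∷-≮ (suc k) A (λ q<k → ℕP.<⇒≱ (ℕP.<-trans k<m m<q) (ℕP.≤-pred q<k)))
             (rank-interval-inside 1 m k (ℕP.<⇒≤ k<m))))))
    where A = applyUpTo suc m

  st-∷-∷-interval : ∀ p q m → m < q → q < p → st (p ∷ q ∷ applyUpTo suc m) ≡ suc (suc m) ∷ suc m ∷ applyUpTo suc m
  st-∷-∷-interval p q m m<q q<p = cong₂ _∷_
    (cong suc (trans (rank-∷-≮ p (q ∷ A) (ℕP.<-irrefl refl))
              (trans (rank-∷-< p A q<p) (cong suc (rank-interval-above 1 m p (ℕP.<-trans m<q q<p))))))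
    (cong₂ _∷_
      (cong suc (trans (rank-∷-≮ q (q ∷ A) (ℕP.<-asym q<p))
                (trans (rank-∷-≮ q A (ℕP.<-irrefl refl)) (rank-interval-above 1 m q m<q))))
      (trans (LP.map-applyUpTo suc _ m) (applyUpTo-cong m (λ k k<m → cong suc
        (trans (rank-∷-≮ (suc k) (q ∷ A) (λ p<k → ℕP.<⇒≱ (ℕP.<-trans k<m (ℕP.<-trans m<q q<p)) (ℕP.≤-pred p<k)))
        (trans (rank-∷-≮ (suc k) A (λ q<k → ℕP.<⇒≱ (ℕP.<-trans k<m m<q) (ℕP.≤-pred q<k)))
               (rank-interval-inside 1 m k (ℕP.<⇒≤ k<m))))))))
    where A = applyUpTo suc m

  take-applyUpTo : ∀ k m (f : ℕ → ℕ) → k ≤ m → take k (applyUpTo f m) ≡ applyUpTo f k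
  take-applyUpTo zero m f _ = refl
  take-applyUpTo (suc k) (suc m) f (s≤s k≤m) = cong (f 0 ∷_) (take-applyUpTo k m (λ x → f (suc x)) k≤m)

  drop-applyUpTo : ∀ k m (f : ℕ → ℕ) → drop k (applyUpTo f m) ≡ applyUpTo (λ j → f (k ℕ.+ j)) (m ∸ k)
  drop-applyUpTo zero m f = refl
  drop-applyUpTo (suc k) zero f = refl
  drop-applyUpTo (suc k) (suc m) f = drop-applyUpTo k m (λ x → f (suc x))

  concatMap-applyUpTo-cong : ∀ {h h' : ℕ → Lin} n (F : ℕ → ℕ) → (∀ i → i < n → h (F i) ≡ h' (F i)) →
    concatMap h (applyUpTo F n) ≡ concatMap h' (applyUpTo F n)
  concatMap-applyUpTo-cong zero F e = refl
  concatMap-applyUpTo-cong (suc n) F e = cong₂ _++_ (e 0 (s≤s z≤n))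
    (concatMap-applyUpTo-cong n (λ x → F (suc x)) (λ i i<n → e (suc i) (s≤s i<n)))

  length-st-take : ∀ i a w → i < suc (length w) → length (st (take i (a ∷ w))) ≤ length w
  length-st-take i a w i≤ = subst (_≤ length w) (sym (trans (LP.length-map _ (take i (a ∷ w))) (LP.length-take i (a ∷ w))))
    (ℕP.≤-trans (ℕP.m⊓n≤m i (suc (length w))) (ℕP.≤-pred i≤))

  antipodeF-fuel : ∀ f g w → length w ≤ f → length w ≤ g → antipodeF f w ≡ antipodeF g w
  antipodeF-fuel zero zero w _ _ = refl
  antipodeF-fuel zero (suc g) [] _ _ = refl
  antipodeF-fuel (suc f) zero [] _ _ = refl
  antipodeF-fuel (suc f) (suc g) [] _ _ = refl
  antipodeF-fuel (suc f) (suc g) (a ∷ w) (s≤s w≤f) (s≤s w≤g) = cong (scale -1ℤ)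
    (concatMap-applyUpTo-cong (suc (length w)) (λ i → i) (λ i i< →
      cong (λ x → mrProd x (st (drop i (a ∷ w))))
        (antipodeF-fuel f g (st (take i (a ∷ w)))
          (ℕP.≤-trans (length-st-take i a w i<) w≤f) (ℕP.≤-trans (length-st-take i a w i<) w≤g))))

  antipodeF-S : ∀ f w → length w ≤ f → antipodeF f w ≡ S w
  antipodeF-S f w w≤f = antipodeF-fuel f (length w) w w≤f ℕP.≤-refl

  antipodeF-[] : ∀ f → antipodeF f [] ≡ ⟪ [] ⟫
  antipodeF-[] zero = refl
  antipodeF-[] (suc f) = refl

  antipodeF-∷ : ∀ f a w → antipodeF (suc f) (a ∷ w) ≋
    scale -1ℤ (sumFrom 0 (suc (length w)) (λ i → mrProd (antipodeF f (st (take i (a ∷ w)))) (st (drop i (a ∷ w)))))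
  antipodeF-∷ f a w = scale-cong -1ℤ (Σ-applyUpTo 0 _ (suc (length w)) (λ i → i) 0 (λ i → refl))

  -- mrProd shifts its second argument by the length of each word of the first; on homogeneous input
  -- that is a single shift, and mrProd becomes a shuffle (mrProd-homogeneous).
  atLength : ℕ → (Word → ℤ) → Word → ℤ
  atLength m G u = χ m (length u) * G u

  Homogeneous : ℕ → Lin → Set
  Homogeneous m x = ∀ G → ev G x ≡ ev (atLength m G) x

  homogeneous-≋ : ∀ {m x y} → x ≋ y → Homogeneous m x → Homogeneous m y
  homogeneous-≋ {m} {x} {y} e hx G = trans (sym (at e G)) (trans (hx G) (at e _))

  homogeneous-scale : ∀ {m} c x → Homogeneous m x → Homogeneous m (scale c x)
  homogeneous-scale c x hx G = trans (ev-scale G c x) (trans (cong (c *_) (hx G)) (sym (ev-scale _ c x)))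

  homogeneous-sumFrom : ∀ {d} a m f → (∀ i → a ≤ i → i < a ℕ.+ m → Homogeneous d (f i)) → Homogeneous d (sumFrom a m f)
  homogeneous-sumFrom a zero f hf G = refl
  homogeneous-sumFrom a (suc m) f hf G =
    trans (ev-++ G (f a) (sumFrom (suc a) m f))
    (trans (cong₂ _+_ (hf a ℕP.≤-refl (ℕP.m<m+n a (s≤s z≤n)) G)
                      (homogeneous-sumFrom (suc a) m f (λ i a<i i< → hf i (ℕP.<⇒≤ a<i) (subst (i <_) (sym (ℕP.+-suc a m)) i<)) G))
           (sym (ev-++ _ (f a) (sumFrom (suc a) m f))))

  homogeneous-∅ : Homogeneous 0 ⟪ [] ⟫
  homogeneous-∅ G = trans (ev-⟪⟫ G []) (sym (trans (ev-⟪⟫ (atLength 0 G) []) (trans (cong (_* G []) (χ-≡ 0)) (*-identityˡ (G [])))))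

  χ-suc : ∀ j a → χ (suc j) (suc a) ≡ χ j a
  χ-suc j a = by-cases (a ℕ.≟ j)
    where
    by-cases : Dec (a ≡ j) → χ (suc j) (suc a) ≡ χ j a
    by-cases (yes refl) = trans (χ-≡ (suc a)) (sym (χ-≡ a))
    by-cases (no a≢j) = trans (χ-≢ (suc j) (suc a) (λ e → a≢j (ℕP.suc-injective e))) (sym (χ-≢ j a a≢j))

  χ-* : ∀ m a (F : ℕ → ℤ) → χ m a * F a ≡ χ m a * F m
  χ-* m a F = by-cases (a ℕ.≟ m)
    where
    by-cases : Dec (a ≡ m) → χ m a * F a ≡ χ m a * F m
    by-cases (yes refl) = refl
    by-cases (no a≢m) = trans (cong (_* F a) (χ-≢ m a a≢m)) (sym (cong (_* F m) (χ-≢ m a a≢m)))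

  Sh-homogeneous : ∀ u v G → Sh u v G ≡ Sh u v (atLength (length u ℕ.+ length v) G)
  Sh-homogeneous [] v G = trans (Sh-[]ˡ v G)
    (sym (trans (Sh-[]ˡ v (atLength (length v) G)) (trans (cong (_* G v) (χ-≡ (length v))) (*-identityˡ (G v)))))
  Sh-homogeneous (a ∷ u) [] G = trans (Sh-[]ʳ (a ∷ u) G)
    (sym (trans (Sh-[]ʳ (a ∷ u) (atLength (length (a ∷ u) ℕ.+ 0) G))
    (trans (cong (_* G (a ∷ u)) (trans (cong (λ l → χ l (suc (length u))) (ℕP.+-identityʳ (suc (length u)))) (χ-≡ (suc (length u)))))
           (*-identityˡ (G (a ∷ u))))))
  Sh-homogeneous (a ∷ u) (b ∷ v) G =
    trans (Sh-∷ a u b v G)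
    (trans (cong₂ _+_
      (trans (Sh-homogeneous u (b ∷ v) (λ w → G (a ∷ w)))
             (Sh-cong u (b ∷ v) (λ w → cong (_* G (a ∷ w)) (sym (χ-suc (length u ℕ.+ length (b ∷ v)) (length w))))))
      (trans (Sh-homogeneous (a ∷ u) v (λ w → G (b ∷ w)))
             (Sh-cong (a ∷ u) v (λ w → cong (_* G (b ∷ w))
               (trans (sym (χ-suc (length (a ∷ u) ℕ.+ length v) (length w)))
                      (cong (λ l → χ l (suc (length w))) (sym (ℕP.+-suc (suc (length u)) (length v)))))))))
    (sym (Sh-∷ a u b v (atLength (length (a ∷ u) ℕ.+ length (b ∷ v)) G))))

  ev-mrProd : ∀ G x τ → ev G (mrProd x τ) ≡ ev (λ π → Sh π (shift (length π) τ) G) x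
  ev-mrProd G x τ = ev-concatMap G _ _ x (λ c π → ev-scale G c (shw π (shift (length π) τ)))

  mrProd-homogeneous : ∀ m x τ → Homogeneous m x → mrProd x τ ≋ x ⧢ ⟪ shift m τ ⟫
  mrProd-homogeneous m x τ hx = mk≋ λ G →
    trans (ev-mrProd G x τ) (trans (hx _)
    (trans (ev-cong x (λ π → χ-* m (length π) (λ a → Sh π (shift a τ) G)))
    (trans (sym (hx (λ π → Sh π (shift m τ) G)))
    (trans (ev-cong x (λ π → sym (ev-⟪⟫ (λ v → Sh π v G) (shift m τ)))) (sym (ev-⧢ G x ⟪ shift m τ ⟫))))))

  homogeneous-mrProd : ∀ m x τ → Homogeneous m x → Homogeneous (m ℕ.+ length τ) (mrProd x τ)
  homogeneous-mrProd m x τ hx G =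
    trans (ev-mrProd G x τ) (trans (hx _)
    (trans (ev-cong x (λ π → trans (cong (χ m (length π) *_) (Sh-homogeneous π (shift (length π) τ) G))
       (trans (χ-* m (length π) (λ a → Sh π (shift a τ) (λ w → χ (a ℕ.+ length (shift a τ)) (length w) * G w)))
         (cong (λ l → χ m (length π) * Sh π (shift m τ) (λ w → χ (m ℕ.+ l) (length w) * G w)) (LP.length-map _ τ)))))
    (trans (sym (ev-cong x (λ π → χ-* m (length π) (λ a → Sh π (shift a τ) (λ w → χ (m ℕ.+ length τ) (length w) * G w)))))
    (trans (sym (hx _)) (sym (ev-mrProd _ x τ))))))

  length-st-take-drop : ∀ i (w : Word) → length (st (take i w)) ℕ.+ length (st (drop i w)) ≡ length w
  length-st-take-drop i w = trans (cong₂ ℕ._+_ (LP.length-map _ (take i w)) (LP.length-map _ (drop i w)))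
    (trans (sym (LP.length-++ (take i w))) (cong length (LP.take++drop≡id i w)))

  homogeneous-antipodeF : ∀ f w → length w ≤ f → Homogeneous (length w) (antipodeF f w)
  homogeneous-antipodeF zero [] _ = homogeneous-∅
  homogeneous-antipodeF (suc f) [] _ = homogeneous-∅
  homogeneous-antipodeF (suc f) (a ∷ w) (s≤s w≤f) =
    homogeneous-≋ (≋-sym (antipodeF-∷ f a w))
      (homogeneous-scale -1ℤ (sumFrom 0 (suc (length w)) term) (homogeneous-sumFrom 0 (suc (length w)) term (λ i _ i< →
        subst (λ l → Homogeneous l (term i)) (length-st-take-drop i (a ∷ w))
              (homogeneous-mrProd _ (antipodeF f (st (take i (a ∷ w)))) (st (drop i (a ∷ w)))
                (homogeneous-antipodeF f (st (take i (a ∷ w))) (ℕP.≤-trans (length-st-take i a w i<) w≤f))))))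
    where
    term : ℕ → Lin
    term i = mrProd (antipodeF f (st (take i (a ∷ w)))) (st (drop i (a ∷ w)))

  Sσ : ℕ → Lin
  Sσ n = S (σₙ n)

  recursionRHS : ℕ → Lin
  recursionRHS n = ltr 1 ⧢ ltr n · η 2 (n ∸ 1) ⊖ ⟪ σₙ n ⟫

  homogeneous-Sσ : ∀ k → Homogeneous (suc (suc k)) (Sσ (suc (suc k)))
  homogeneous-Sσ k = subst (λ l → Homogeneous (suc (suc l)) (Sσ (suc (suc k))))
    (LP.length-applyUpTo suc k) (homogeneous-antipodeF _ (σₙ (suc (suc k))) ℕP.≤-refl)

  mrProd-∅ : ∀ τ → mrProd ⟪ [] ⟫ τ ≋ ⟪ τ ⟫
  mrProd-∅ τ = mk≋ λ G → trans (ev-mrProd G ⟪ [] ⟫ τ)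
    (trans (ev-⟪⟫ (λ π → Sh π (shift (length π) τ) G) []) (trans (Sh-[]ˡ (shift 0 τ) G)
    (trans (cong G (LP.map-id τ)) (sym (ev-⟪⟫ G τ)))))

  antipodeF-1 : ∀ f → antipodeF (suc f) (1 ∷ []) ≋ scale -1ℤ ⟪ 1 ∷ [] ⟫
  antipodeF-1 f = ≋-trans (antipodeF-∷ f 1 [])
    (scale-cong -1ℤ (≋-trans (⊕-identityʳ _)
      (≋-trans (≋-reflexive (cong (λ x → mrProd x (1 ∷ [])) (antipodeF-[] f))) (mrProd-∅ (1 ∷ [])))))

  -- The summands of the antipode recursion for σₙ: the prefix of length i ≥ 2 standardizes to σᵢ,
  -- and the suffix to an interval which the product shifts to η_{i+1,n}.
  module σₙ-Terms (m : ℕ) where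
    n = suc (suc m)
    A = applyUpTo suc m
    fuel = suc (length A)

    term : ℕ → Lin
    term i = mrProd (antipodeF fuel (st (take i (σₙ n)))) (st (drop i (σₙ n)))

    term₀ : term 0 ≋ ⟪ σₙ n ⟫
    term₀ = ≋-trans (mrProd-∅ (st (σₙ n))) (≋-reflexive (cong ⟪_⟫ (st-∷-∷-interval n (suc m) m ℕP.≤-refl ℕP.≤-refl)))

    term₁ : term 1 ≋ scale -1ℤ (ltr 1 ⧢ ltr n · η 2 (suc m))
    term₁ =
      begin
        mrProd (antipodeF fuel (st (n ∷ []))) (st (drop 1 (σₙ n)))
      ≋⟨ ≋-reflexive (cong (λ w → mrProd (antipodeF fuel w) (st (drop 1 (σₙ n)))) (st-single n)) ⟩
        mrProd (antipodeF fuel (1 ∷ [])) (st (suc m ∷ A))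
      ≋⟨ mrProd-homogeneous 1 (antipodeF fuel (1 ∷ [])) (st (suc m ∷ A)) (homogeneous-antipodeF fuel (1 ∷ []) (s≤s z≤n)) ⟩
        antipodeF fuel (1 ∷ []) ⧢ ⟪ shift 1 (st (suc m ∷ A)) ⟫
      ≋⟨ ⧢-cong (antipodeF-1 (length A)) (≋-reflexive (cong (λ w → ⟪ shift 1 w ⟫) (st-∷-interval (suc m) m ℕP.≤-refl))) ⟩
        scale -1ℤ ⟪ 1 ∷ [] ⟫ ⧢ ⟪ n ∷ map (1 ℕ.+_) A ⟫
      ≋⟨ ⧢-scaleˡ -1ℤ ⟪ 1 ∷ [] ⟫ ⟪ n ∷ map (1 ℕ.+_) A ⟫ ⟩
        scale -1ℤ (ltr 1 ⧢ ⟪ n ∷ map (1 ℕ.+_) A ⟫)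
      ≋⟨ scale-cong -1ℤ (⧢-congʳ (ltr 1) (≋-sym (≋-trans (·-congʳ (ltr n) (≋-reflexive (η-word 2 (suc m) (s≤s (s≤s z≤n)))))
           (≋-trans (ltr-·-⟪⟫ n (ηw 2 (suc m))) (≋-reflexive (cong (λ w → ⟪ n ∷ w ⟫) (sym (LP.map-applyUpTo suc (1 ℕ.+_) m)))))))) ⟩
        scale -1ℤ (ltr 1 ⧢ ltr n · η 2 (suc m))
      ∎
      where open ≋-Reasoning

    term-inner : ∀ i → 2 ≤ i → i < 2 ℕ.+ m → term i ≋ Sσ i ⧢ η (suc i) n
    term-inner (suc (suc k)) (s≤s (s≤s _)) (s≤s (s≤s k<m)) =
      begin
        mrProd (antipodeF fuel (st (n ∷ suc m ∷ take k A))) (st (drop k A))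
      ≋⟨ ≋-reflexive (cong (λ w → mrProd (antipodeF fuel w) (st (drop k A)))
            (trans (cong (λ w → st (n ∷ suc m ∷ w)) (take-applyUpTo k m suc (ℕP.<⇒≤ k<m)))
                   (st-∷-∷-interval n (suc m) k (s≤s (ℕP.<⇒≤ k<m)) ℕP.≤-refl))) ⟩
        mrProd (antipodeF fuel (σₙ (suc (suc k)))) (st (drop k A))
      ≋⟨ ≋-reflexive (cong (λ x → mrProd x (st (drop k A)))
            (antipodeF-S fuel (σₙ (suc (suc k)))
              (s≤s (subst₂ (λ a b → suc a ≤ b) (sym (LP.length-applyUpTo suc k)) (sym (LP.length-applyUpTo suc m)) k<m)))) ⟩
        mrProd (Sσ (suc (suc k))) (st (drop k A))
      ≋⟨ mrProd-homogeneous (suc (suc k)) (Sσ (suc (suc k))) (st (drop k A)) (homogeneous-Sσ k) ⟩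
        Sσ (suc (suc k)) ⧢ ⟪ shift (suc (suc k)) (st (drop k A)) ⟫
      ≋⟨ ⧢-congʳ (Sσ (suc (suc k))) (≋-reflexive (trans (cong ⟪_⟫ dropped) (sym (η-word (suc (suc (suc k))) n (s≤s (s≤s (s≤s (ℕP.<⇒≤ k<m)))))))) ⟩
        Sσ (suc (suc k)) ⧢ η (suc (suc (suc k))) n
      ∎
      where
      open ≋-Reasoning
      dropped : shift (suc (suc k)) (st (drop k A)) ≡ ηw (suc (suc (suc k))) n
      dropped =
        trans (cong (λ w → shift (suc (suc k)) (st w)) (drop-applyUpTo k m suc))
        (trans (cong (shift (suc (suc k))) (st-interval (suc k) (m ∸ k)))
        (trans (LP.map-applyUpTo suc (suc (suc k) ℕ.+_) (m ∸ k))
               (applyUpTo-cong (m ∸ k) (λ j _ → cong (λ l → suc (suc l)) (ℕP.+-suc k j)))))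

  S-σₙ : ∀ m → Sσ (suc (suc m)) ≋
    scale -1ℤ (⟪ σₙ (suc (suc m)) ⟫ ⊕ (scale -1ℤ (ltr 1 ⧢ ltr (suc (suc m)) · η 2 (suc m))
                                      ⊕ sumFrom 2 m (λ i → Sσ i ⧢ η (suc i) (suc (suc m)))))
  S-σₙ m = ≋-trans (antipodeF-∷ fuel n (suc m ∷ A))
    (scale-cong -1ℤ (⊕-cong term₀ (⊕-cong term₁
      (≋-trans (≋-reflexive (cong (λ l → sumFrom 2 l term) (LP.length-applyUpTo suc m)))
               (sumFrom-cong 2 m term-inner)))))
    where open σₙ-Terms m

  Sσ-recursion : ∀ m → sumFrom 2 (suc m) (λ i → Sσ i ⧢ η (suc i) (suc (suc m))) ≋ recursionRHS (suc (suc m))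
  Sσ-recursion m = mk≋ λ G →
    begin
      ev G (sumFrom 2 (suc m) f)
    ≡⟨ at (≋-trans (sumFrom-last 2 m f) (⊕-congʳ (sumFrom 2 m f) (≋-trans (⧢-η-∅ (Sσ n) n) (S-σₙ m)))) G ⟩
      ev G (sumFrom 2 m f ⊕ scale -1ℤ (⟪ σₙ n ⟫ ⊕ (scale -1ℤ shuffled ⊕ sumFrom 2 m f)))
    ≡⟨ trans (ev-++ G (sumFrom 2 m f) (scale -1ℤ (⟪ σₙ n ⟫ ⊕ rest)))
        (cong (ev G (sumFrom 2 m f) +_) (trans (ev-scale G -1ℤ (⟪ σₙ n ⟫ ⊕ rest)) (cong (-1ℤ *_)
          (trans (ev-++ G ⟪ σₙ n ⟫ rest) (cong (ev G ⟪ σₙ n ⟫ +_)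
            (trans (ev-++ G (scale -1ℤ shuffled) (sumFrom 2 m f)) (cong (_+ ev G (sumFrom 2 m f)) (ev-scale G -1ℤ shuffled)))))))) ⟩
      ev G (sumFrom 2 m f) + -1ℤ * (ev G ⟪ σₙ n ⟫ + (-1ℤ * ev G shuffled + ev G (sumFrom 2 m f)))
    ≡⟨ cancel (ev G (sumFrom 2 m f)) (ev G ⟪ σₙ n ⟫) (ev G shuffled) ⟩
      ev G shuffled - ev G ⟪ σₙ n ⟫
    ≡⟨ sym (ev-⊖ G shuffled ⟪ σₙ n ⟫) ⟩
      ev G (recursionRHS n)
    ∎
    where
    open ≡-Reasoning
    n = suc (suc m)
    shuffled = ltr 1 ⧢ ltr n · η 2 (suc m)
    f : ℕ → Lin
    f i = Sσ i ⧢ η (suc i) n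
    rest = scale -1ℤ shuffled ⊕ sumFrom 2 m f
    cancel : ∀ s g h → s + -1ℤ * (g + (-1ℤ * h + s)) ≡ h - g
    cancel = solve-∀

  strip-Sσ-recursion : ∀ m j → j ≢ suc (suc m) →
    sumFrom 2 (suc m) (λ i → strip j (Sσ i) ⧢ η (suc i) (suc (suc m))) ≋ strip j (recursionRHS (suc (suc m)))
  strip-Sσ-recursion m j j≢n =
    ≋-trans (sumFrom-cong 2 (suc m) (λ i _ i< → ≋-sym (strip-⧢-η-≢ j (Sσ i) i (suc (suc m)) (ℕP.≤-pred i<) j≢n)))
    (≋-trans (≋-sym (strip-sumFrom j 2 (suc m) (λ i → Sσ i ⧢ η (suc i) (suc (suc m))))) (strip-cong j (Sσ-recursion m)))

  strip-ltr1-⧢-⊖ : ∀ j W b σ' c → strip j (ltr 1 ⧢ ⟪ W ∷ʳ b ⟫ ⊖ ⟪ σ' ∷ʳ c ⟫) ≋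
    scale (χ j 1) ⟪ W ∷ʳ b ⟫ ⊕ scale (χ j b) (ltr 1 ⧢ ⟪ W ⟫) ⊖ scale (χ j c) ⟪ σ' ⟫
  strip-ltr1-⧢-⊖ j W b σ' c =
    ≋-trans (strip-⊖ j (ltr 1 ⧢ ⟪ W ∷ʳ b ⟫) ⟪ σ' ∷ʳ c ⟫)
    (⊖-cong (≋-trans (strip-⧢-∷ʳ j (ltr 1) W b)
                     (⊕-congˡ (scale (χ j b) (ltr 1 ⧢ ⟪ W ⟫))
                              (≋-trans (⧢-congˡ ⟪ W ∷ʳ b ⟫ (strip-⟪∷ʳ⟫ j [] 1))
                                       (≋-trans (⧢-scaleˡ (χ j 1) ⟪ [] ⟫ ⟪ W ∷ʳ b ⟫) (scale-cong (χ j 1) (∅-⧢ ⟪ W ∷ʳ b ⟫))))))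
            (strip-⟪∷ʳ⟫ j σ' c))

  ev-χ-combination : ∀ G j a b c x y z →
    ev G (scale (χ j a) x ⊕ scale (χ j b) y ⊖ scale (χ j c) z) ≡ χ j a * ev G x + χ j b * ev G y - χ j c * ev G z
  ev-χ-combination G j a b c x y z =
    trans (ev-⊖ G (scale (χ j a) x ⊕ scale (χ j b) y) (scale (χ j c) z))
    (cong₂ _-_ (trans (ev-++ G (scale (χ j a) x) (scale (χ j b) y)) (cong₂ _+_ (ev-scale G (χ j a) x) (ev-scale G (χ j b) y)))
               (ev-scale G (χ j c) z))

  recursionRHS-2 : recursionRHS 2 ≋ ltr 1 ⧢ ⟪ [] ∷ʳ 2 ⟫ ⊖ ⟪ (2 ∷ []) ∷ʳ 1 ⟫
  recursionRHS-2 = ⊖-cong (⧢-congʳ (ltr 1) (≋-trans (·-congʳ (ltr 2) (≋-reflexive (η-∅ 1))) (ltr-·-⟪⟫ 2 []))) ≋-refl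

  module RHS (m : ℕ) where
    n = suc (suc (suc m))
    W = n ∷ applyUpTo (2 ℕ.+_) m
    σ' = n ∷ suc (suc m) ∷ applyUpTo suc m

    recursionRHS-shape : recursionRHS n ≋ ltr 1 ⧢ ⟪ W ∷ʳ suc (suc m) ⟫ ⊖ ⟪ σ' ∷ʳ suc m ⟫
    recursionRHS-shape = ⊖-cong
      (⧢-congʳ (ltr 1) (≋-trans (·-congʳ (ltr n) (≋-reflexive (η-word 2 (suc (suc m)) (s≤s (s≤s z≤n)))))
        (≋-trans (ltr-·-⟪⟫ n (ηw 2 (suc (suc m)))) (≋-reflexive (cong (λ w → ⟪ n ∷ w ⟫) (sym (LP.applyUpTo-∷ʳ (2 ℕ.+_) m)))))))
      (≋-reflexive (cong (λ w → ⟪ n ∷ suc (suc m) ∷ w ⟫) (sym (LP.applyUpTo-∷ʳ suc m))))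

    ev-strip-RHS : ∀ G j → ev G (strip j (recursionRHS n)) ≡
      χ j 1 * ev G ⟪ W ∷ʳ suc (suc m) ⟫ + χ j (suc (suc m)) * ev G (ltr 1 ⧢ ⟪ W ⟫) - χ j (suc m) * ev G ⟪ σ' ⟫
    ev-strip-RHS G j = trans (at (≋-trans (strip-cong j recursionRHS-shape) (strip-ltr1-⧢-⊖ j W (suc (suc m)) σ' (suc m))) G)
      (ev-χ-combination G j 1 (suc (suc m)) (suc m) ⟪ W ∷ʳ suc (suc m) ⟫ (ltr 1 ⧢ ⟪ W ⟫) ⟪ σ' ⟫)

    ev-strip-RHS-at : ∀ G j {α β γ} → χ j 1 ≡ α → χ j (suc (suc m)) ≡ β → χ j (suc m) ≡ γ →
      ev G (strip j (recursionRHS n)) ≡ α * ev G ⟪ W ∷ʳ suc (suc m) ⟫ + β * ev G (ltr 1 ⧢ ⟪ W ⟫) - γ * ev G ⟪ σ' ⟫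
    ev-strip-RHS-at G j refl refl refl = ev-strip-RHS G j

    strip-RHS-vanishes : ∀ j → 1 ≢ j → suc (suc m) ≢ j → suc m ≢ j → strip j (recursionRHS n) ≋ 𝟘
    strip-RHS-vanishes j 1≢j 2+m≢j 1+m≢j = mk≋ λ G →
      trans (ev-strip-RHS-at G j (χ-≢ j 1 1≢j) (χ-≢ j (suc (suc m)) 2+m≢j) (χ-≢ j (suc m) 1+m≢j))
            (none (ev G ⟪ W ∷ʳ suc (suc m) ⟫) (ev G (ltr 1 ⧢ ⟪ W ⟫)) (ev G ⟪ σ' ⟫))
      where
      none : ∀ x y z → 0ℤ * x + 0ℤ * y - 0ℤ * z ≡ 0ℤ
      none = solve-∀

    strip-RHS-penultimate : strip (suc (suc m)) (recursionRHS n) ≋ ltr 1 ⧢ ltr n · η 2 (suc m)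
    strip-RHS-penultimate = mk≋ λ G →
      trans (ev-strip-RHS-at G (suc (suc m)) (χ-≢ (suc (suc m)) 1 (λ ())) (χ-≡ (suc (suc m)))
                                             (χ-≢ (suc (suc m)) (suc m) (λ e → ℕP.<-irrefl e ℕP.≤-refl)))
      (trans (second (ev G ⟪ W ∷ʳ suc (suc m) ⟫) (ev G (ltr 1 ⧢ ⟪ W ⟫)) (ev G ⟪ σ' ⟫))
             (at (⧢-congʳ (ltr 1) (≋-sym (≋-trans (·-congʳ (ltr n) (≋-reflexive (η-word 2 (suc m) (s≤s (s≤s z≤n)))))
                                                 (ltr-·-⟪⟫ n (ηw 2 (suc m)))))) G))
      where
      second : ∀ x y z → 0ℤ * x + 1ℤ * y - 0ℤ * z ≡ y
      second = solve-∀

  strip-RHS-first : ∀ k → strip 1 (recursionRHS (4 ℕ.+ k)) ≋ ltr (4 ℕ.+ k) · η 2 (3 ℕ.+ k)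
  strip-RHS-first k = mk≋ λ G →
    trans (ev-strip-RHS-at G 1 (χ-≡ 1) (χ-≢ 1 (3 ℕ.+ k) (λ ())) (χ-≢ 1 (2 ℕ.+ k) (λ ())))
    (trans (first (ev G ⟪ W ∷ʳ (3 ℕ.+ k) ⟫) (ev G (ltr 1 ⧢ ⟪ W ⟫)) (ev G ⟪ σ' ⟫))
           (at (≋-sym (≋-trans (·-congʳ (ltr n) (≋-reflexive (η-word 2 (3 ℕ.+ k) (s≤s (s≤s z≤n)))))
                      (≋-trans (ltr-·-⟪⟫ n (ηw 2 (3 ℕ.+ k)))
                               (≋-reflexive (cong (λ w → ⟪ n ∷ w ⟫) (sym (LP.applyUpTo-∷ʳ (2 ℕ.+_) (suc k)))))))) G))
    where
    open RHS (suc k)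
    first : ∀ x y z → 1ℤ * x + 0ℤ * y - 0ℤ * z ≡ x
    first = solve-∀

  strip-RHS-antepenultimate : ∀ k → strip (2 ℕ.+ k) (recursionRHS (4 ℕ.+ k)) ≋ scale -1ℤ (δ (4 ℕ.+ k) (3 ℕ.+ k) · η 1 (1 ℕ.+ k))
  strip-RHS-antepenultimate k = mk≋ λ G →
    trans (ev-strip-RHS-at G (2 ℕ.+ k) (χ-≢ (2 ℕ.+ k) 1 (λ ()))
                                       (χ-≢ (2 ℕ.+ k) (3 ℕ.+ k) (λ e → ℕP.<-irrefl (sym e) ℕP.≤-refl)) (χ-≡ (2 ℕ.+ k)))
    (trans (third (ev G ⟪ W ∷ʳ (3 ℕ.+ k) ⟫) (ev G (ltr 1 ⧢ ⟪ W ⟫)) (ev G ⟪ σ' ⟫))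
           (sym (trans (ev-scale G -1ℤ (δ (4 ℕ.+ k) (3 ℕ.+ k) · η 1 (1 ℕ.+ k))) (cong (-1ℤ *_) (at (δη-word (2 ℕ.+ k) (1 ℕ.+ k)) G)))))
    where
    open RHS (suc k)
    third : ∀ x y z → 0ℤ * x + 0ℤ * y - 1ℤ * z ≡ -1ℤ * z
    third = solve-∀

  strip-1-RHS-3 : strip 1 (recursionRHS 3) ≋ 𝟘
  strip-1-RHS-3 = mk≋ λ G →
    trans (ev-strip-RHS-at G 1 (χ-≡ 1) (χ-≢ 1 2 (λ ())) (χ-≡ 1)) (cancel (ev G ⟪ σ' ⟫) (ev G (ltr 1 ⧢ ⟪ W ⟫)))
    where
    open RHS 0
    cancel : ∀ x y → 1ℤ * x + 0ℤ * y - 1ℤ * x ≡ 0ℤ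
    cancel = solve-∀

  ev-strip-RHS-2-at : ∀ G j {α β} → χ j 1 ≡ α → χ j 2 ≡ β →
    ev G (strip j (recursionRHS 2)) ≡ α * ev G ⟪ 2 ∷ [] ⟫ + β * ev G (ltr 1 ⧢ ⟪ [] ⟫) - α * ev G ⟪ 2 ∷ [] ⟫
  ev-strip-RHS-2-at G j refl refl =
    trans (at (≋-trans (strip-cong j recursionRHS-2) (strip-ltr1-⧢-⊖ j [] 2 (2 ∷ []) 1)) G)
          (ev-χ-combination G j 1 2 1 ⟪ 2 ∷ [] ⟫ (ltr 1 ⧢ ⟪ [] ⟫) ⟪ 2 ∷ [] ⟫)

  strip-RHS-2 : ∀ j → 2 ≢ j → strip j (recursionRHS 2) ≋ 𝟘
  strip-RHS-2 j 2≢j = mk≋ λ G →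
    trans (ev-strip-RHS-2-at G j refl (χ-≢ j 2 2≢j)) (cancel (χ j 1) (ev G ⟪ 2 ∷ [] ⟫) (ev G (ltr 1 ⧢ ⟪ [] ⟫)))
    where
    cancel : ∀ a x y → a * x + 0ℤ * y - a * x ≡ 0ℤ
    cancel = solve-∀

  strip-2-RHS-2 : strip 2 (recursionRHS 2) ≋ ltr 1
  strip-2-RHS-2 = mk≋ λ G →
    trans (ev-strip-RHS-2-at G 2 refl (χ-≡ 2))
    (trans (second (χ 2 1) (ev G ⟪ 2 ∷ [] ⟫) (ev G (ltr 1 ⧢ ⟪ [] ⟫))) (at (⧢-∅ (ltr 1)) G))
    where
    second : ∀ a x y → a * x + 1ℤ * y - a * x ≡ y
    second = solve-∀


  ⊕-cancelˡ : ∀ {x x' y y' z} → x ≋ x' → x ⊕ y ≋ z → x' ⊕ y' ≋ z → y ≋ y'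
  ⊕-cancelˡ {x} {x'} {y} {y'} {z} x≋x' e e' = mk≋ λ G →
    cancel (at x≋x' G) (trans (sym (ev-++ G x y)) (at e G)) (trans (sym (ev-++ G x' y')) (at e' G))
    where
    cancel : ∀ {p p' a b r : ℤ} → p ≡ p' → p + a ≡ r → p' + b ≡ r → a ≡ b
    cancel {p} {_} {a} {b} refl e₁ e₂ = trans (sym (-p+p+ p a)) (trans (cong (- p +_) (trans e₁ (sym e₂))) (-p+p+ p b))
      where
      -p+p+ : ∀ p a → - p + (p + a) ≡ a
      -p+p+ = solve-∀

  -- The summand i = n of the n-th equation is X n ⧢ η_{n+1,n} = X n.
  η-recursion-unique : ∀ (X Y R : ℕ → Lin) N₀ N → X N₀ ≋ Y N₀ →
    (∀ n → N₀ < n → n ≤ N → sumFrom N₀ (suc n ∸ N₀) (λ i → X i ⧢ η (suc i) n) ≋ R n) →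
    (∀ n → N₀ < n → n ≤ N → sumFrom N₀ (suc n ∸ N₀) (λ i → Y i ⧢ η (suc i) n) ≋ R n) →
    ∀ n → N₀ ≤ n → n ≤ N → X n ≋ Y n
  η-recursion-unique X Y R N₀ N base hX hY = <-rec _ step
    where
    step : ∀ n → (∀ {i} → i < n → N₀ ≤ i → i ≤ N → X i ≋ Y i) → N₀ ≤ n → n ≤ N → X n ≋ Y n
    step n earlier N₀≤n n≤N with ℕP.m≤n⇒m<n∨m≡n N₀≤n
    ... | inj₂ refl = base
    ... | inj₁ N₀<n =
      ≋-trans (≋-sym (⧢-η-∅ (X n) n))
      (≋-trans (⊕-cancelˡ
                  (sumFrom-cong N₀ (n ∸ N₀) (λ i N₀≤i i< → ⧢-congˡ (η (suc i) n)
                    (earlier (subst (i <_) (ℕP.m+[n∸m]≡n N₀≤n) i<) N₀≤i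
                             (ℕP.≤-trans (ℕP.<⇒≤ (subst (i <_) (ℕP.m+[n∸m]≡n N₀≤n) i<)) n≤N))))
                  (≋-trans (≋-sym (sumFrom-upTo N₀ n (λ i → X i ⧢ η (suc i) n) N₀≤n)) (hX n N₀<n n≤N))
                  (≋-trans (≋-sym (sumFrom-upTo N₀ n (λ i → Y i ⧢ η (suc i) n) N₀≤n)) (hY n N₀<n n≤N)))
               (⧢-η-∅ (Y n) n))

  Sσ-2 : Sσ 2 ≋ recursionRHS 2
  Sσ-2 = ≋-trans (≋-sym (≋-trans (⊕-identityʳ (Sσ 2 ⧢ η 3 2)) (⧢-η-∅ (Sσ 2) 2))) (Sσ-recursion 0)

  strip-Sσ-vanishes : ∀ i j → 2 ≤ i → i < j → strip j (Sσ i) ≋ 𝟘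
  strip-Sσ-vanishes i (suc j') 2≤i (s≤s i≤j') =
    η-recursion-unique (λ i → strip j (Sσ i)) (λ _ → 𝟘) (λ _ → 𝟘) 2 j'
      (≋-trans (strip-cong j Sσ-2) (strip-RHS-2 j (λ e → ℕP.<-irrefl e (ℕP.≤-trans (s≤s 2≤j') ℕP.≤-refl))))
      hX (λ n _ _ → sumFrom-zero 2 (suc n ∸ 2) _ (λ i _ _ → ⧢-zeroˡ (η (suc i) n)))
      i 2≤i i≤j'
    where
    j = suc j'
    2≤j' = ℕP.≤-trans 2≤i i≤j'
    hX : ∀ n → 2 < n → n ≤ j' → sumFrom 2 (suc n ∸ 2) (λ i → strip j (Sσ i) ⧢ η (suc i) n) ≋ 𝟘
    hX (suc (suc (suc m))) _ n≤j' =
      ≋-trans (strip-Sσ-recursion (suc m) j (λ e → ℕP.<-irrefl (sym e) (s≤s n≤j')))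
      (RHS.strip-RHS-vanishes m j (λ e → ℕP.<-irrefl e (ℕP.≤-trans (s≤s (s≤s z≤n)) (ℕP.≤-trans (s≤s (s≤s (s≤s z≤n))) (s≤s n≤j'))))
                                   (λ e → ℕP.<-irrefl e (s≤s (ℕP.≤-trans (ℕP.n≤1+n _) n≤j')))
                                   (λ e → ℕP.<-irrefl e (s≤s (ℕP.≤-trans (ℕP.≤-trans (ℕP.n≤1+n _) (ℕP.n≤1+n _)) n≤j'))))
    hX (suc zero) (s≤s ()) _
    hX (suc (suc zero)) (s≤s (s≤s ())) _

  ⊕≋𝟘⇒≋-neg : ∀ {x y} → x ⊕ y ≋ 𝟘 → y ≋ scale -1ℤ x
  ⊕≋𝟘⇒≋-neg {x} {y} e = mk≋ λ G →
    trans (solve-y (ev G x) (ev G y) (trans (sym (ev-++ G x y)) (at e G))) (sym (ev-scale G -1ℤ x))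
    where
    solve-y : ∀ a b → a + b ≡ 0ℤ → b ≡ -1ℤ * a
    solve-y a b a+b≡0 = trans (sym (rearrange a b)) (trans (cong (_+ -1ℤ * a) a+b≡0) (+-identityˡ (-1ℤ * a)))
      where
      rearrange : ∀ a b → (a + b) + -1ℤ * a ≡ b
      rearrange = solve-∀

  strip-last-Sσ : ∀ k → strip (3 ℕ.+ k) (Sσ (3 ℕ.+ k)) ≋ scale -1ℤ (recursionRHS (2 ℕ.+ k))
  strip-last-Sσ k = ⊕≋𝟘⇒≋-neg
    (begin
      recursionRHS (2 ℕ.+ k) ⊕ strip n (Sσ n)
    ≋⟨ ⊕-cong (≋-sym (Sσ-recursion k)) (≋-sym (strip-cong n (⧢-η-∅ (Sσ n) n))) ⟩
      sumFrom 2 (suc k) (λ i → Sσ i ⧢ η (suc i) (2 ℕ.+ k)) ⊕ strip n (Sσ n ⧢ η (suc n) n)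
    ≋⟨ ⊕-congˡ (strip n (Sσ n ⧢ η (suc n) n)) (sumFrom-cong 2 (suc k) (λ i 2≤i i< → ≋-sym (strip-top i 2≤i i<))) ⟩
      sumFrom 2 (suc k) (λ i → strip n (Sσ i ⧢ η (suc i) n)) ⊕ strip n (Sσ n ⧢ η (suc n) n)
    ≋⟨ ≋-sym (≋-trans (strip-sumFrom n 2 (2 ℕ.+ k) (λ i → Sσ i ⧢ η (suc i) n))
                      (sumFrom-last 2 (suc k) (λ i → strip n (Sσ i ⧢ η (suc i) n)))) ⟩
      strip n (sumFrom 2 (2 ℕ.+ k) (λ i → Sσ i ⧢ η (suc i) n))
    ≋⟨ strip-cong n (Sσ-recursion (suc k)) ⟩
      strip n (recursionRHS n)
    ≋⟨ RHS.strip-RHS-vanishes k n (λ ()) (λ e → ℕP.<-irrefl e ℕP.≤-refl) (λ e → ℕP.<-irrefl e (ℕP.n≤1+n _)) ⟩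
      𝟘
    ∎)
    where
    open ≋-Reasoning
    n = 3 ℕ.+ k
    strip-top : ∀ i → 2 ≤ i → i < 2 ℕ.+ suc k → strip n (Sσ i ⧢ η (suc i) n) ≋ Sσ i ⧢ η (suc i) (2 ℕ.+ k)
    strip-top i 2≤i i<n =
      ≋-trans (strip-⧢-η n (Sσ i) i n i<n)
      (≋-trans (⊕-cong (⧢-congˡ (η (suc i) n) (strip-Sσ-vanishes i n 2≤i i<n)) (scale-χ-≡ n (Sσ i ⧢ η (suc i) (2 ℕ.+ k))))
               (⊕-identityˡ (Sσ i ⧢ η (suc i) (2 ℕ.+ k))))

  ηSum-⊕ : ∀ F G n m → ηSum (λ i → F i ⊕ G i) n m ≋ ηSum F n m ⊕ ηSum G n m
  ηSum-⊕ F G n m =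
    ≋-trans (sumFrom-cong′ m (suc n ∸ m) (λ i → ≋-trans (scale-cong (sgn i) (⧢-⊕ˡ (F i) (G i) (η (suc i) n)))
                                                     (scale-⊕ (sgn i) (F i ⧢ η (suc i) n) (G i ⧢ η (suc i) n))))
            (sumFrom-⊕ m (suc n ∸ m) _ _)

  sumFrom-signed-⧢-η : ∀ c F n m →
    sumFrom m (suc n ∸ m) (λ i → scale c (scale (sgn i) (F i)) ⧢ η (suc i) n) ≋ scale c (ηSum F n m)
  sumFrom-signed-⧢-η c F n m =
    ≋-trans (sumFrom-cong′ m (suc n ∸ m) (λ i →
              ≋-trans (⧢-scaleˡ c (scale (sgn i) (F i)) (η (suc i) n)) (scale-cong c (⧢-scaleˡ (sgn i) (F i) (η (suc i) n)))))
            (sumFrom-scale m (suc n ∸ m) c _)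

  shuffleFour : ℕ → Lin
  shuffleFour i = (ltr 3 ⧢ δ i 5) · ltr 4

  δ5-4 : ℕ → Lin
  δ5-4 i = δ i 5 · ltr 4

  ∅-at-4 : ℕ → Lin
  ∅-at-4 4 = ⟪ [] ⟫
  ∅-at-4 _ = 𝟘

  shuffleFour-∷ : ∀ i → 4 ≤ i → shuffleFour i ≋ ltr 3 · δ5-4 i ⊕ ltr i · shuffleFour (i ∸ 1)
  shuffleFour-∷ 0 ()
  shuffleFour-∷ 1 (s≤s ())
  shuffleFour-∷ 2 (s≤s (s≤s ()))
  shuffleFour-∷ 3 (s≤s (s≤s (s≤s ())))
  shuffleFour-∷ 4 _ =
    begin
      (ltr 3 ⧢ δ 4 5) · ltr 4
    ≋⟨ ·-congˡ (ltr 4) (⧢-δ-∅ (ltr 3) 4) ⟩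
      ltr 3 · ltr 4
    ≋⟨ ≋-sym (≋-trans (⊕-cong (·-congʳ (ltr 3) (≋-trans (·-congˡ (ltr 4) (≋-reflexive (δ-∅ 4))) (∅-· (ltr 4))))
                              (≋-trans (·-congʳ (ltr 4) (·-congˡ (ltr 4) (⧢-δ-zero (ltr 3) 3 5 ℕP.≤-refl))) (·-zeroʳ (ltr 4))))
                      (⊕-identityʳ (ltr 3 · ltr 4))) ⟩
      ltr 3 · δ5-4 4 ⊕ ltr 4 · shuffleFour 3
    ∎
    where open ≋-Reasoning
  shuffleFour-∷ (suc i@(suc (suc (suc (suc _))))) _ =
    begin
      (ltr 3 ⧢ δ (suc i) 5) · ltr 4
    ≋⟨ ·-congˡ (ltr 4) (⧢-cong (≋-sym (ltr-·-⟪⟫ 3 [])) δ-head) ⟩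
      ((ltr 3 · ⟪ [] ⟫) ⧢ (ltr (suc i) · δ i 5)) · ltr 4
    ≋⟨ ≋-trans (·-congˡ (ltr 4) (ltr-·-⧢-ltr-· 3 ⟪ [] ⟫ (suc i) (δ i 5))) (·-⊕ˡ (ltr 3 · A) (ltr (suc i) · B) (ltr 4)) ⟩
      (ltr 3 · A) · ltr 4 ⊕ (ltr (suc i) · B) · ltr 4
    ≋⟨ ⊕-cong (≋-trans (·-assoc (ltr 3) A (ltr 4)) (·-congʳ (ltr 3) (·-congˡ (ltr 4) (≋-trans (∅-⧢ (ltr (suc i) · δ i 5)) (≋-sym δ-head)))))
              (≋-trans (·-assoc (ltr (suc i)) B (ltr 4)) (·-congʳ (ltr (suc i)) (·-congˡ (ltr 4) (⧢-congˡ (δ i 5) (ltr-·-⟪⟫ 3 []))))) ⟩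
      ltr 3 · δ5-4 (suc i) ⊕ ltr (suc i) · shuffleFour i
    ∎
    where
    open ≋-Reasoning
    δ-head : δ (suc i) 5 ≋ ltr (suc i) · δ i 5
    δ-head = δ-∷ i 5 (s≤s (s≤s (s≤s (s≤s (s≤s z≤n)))))
    A = ⟪ [] ⟫ ⧢ (ltr (suc i) · δ i 5)
    B = (ltr 3 · ⟪ [] ⟫) ⧢ δ i 5

  δ5-4-∷ : ∀ i → 4 ≤ i → δ5-4 i ≋ ltr 4 · ∅-at-4 i ⊕ ltr i · δ5-4 (i ∸ 1)
  δ5-4-∷ 0 ()
  δ5-4-∷ 1 (s≤s ())
  δ5-4-∷ 2 (s≤s (s≤s ()))
  δ5-4-∷ 3 (s≤s (s≤s (s≤s ())))
  δ5-4-∷ 4 _ =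
    ≋-trans (·-congˡ (ltr 4) (≋-reflexive (δ-∅ 4)))
    (≋-trans (∅-· (ltr 4)) (≋-sym (≋-trans (⊕-congʳ (ltr 4 · ⟪ [] ⟫)
      (≋-trans (·-congʳ (ltr 4) (·-congˡ (ltr 4) (≋-reflexive (δ-zero 3 5 ℕP.≤-refl)))) (·-zeroʳ (ltr 4))))
      (≋-trans (⊕-identityʳ (ltr 4 · ⟪ [] ⟫)) (ltr-·-⟪⟫ 4 [])))))
  δ5-4-∷ (suc i@(suc (suc (suc (suc _))))) _ =
    ≋-trans (·-congˡ (ltr 4) (δ-∷ i 5 (s≤s (s≤s (s≤s (s≤s (s≤s z≤n)))))))
    (≋-trans (·-assoc (ltr (suc i)) (δ i 5) (ltr 4))
    (≋-sym (≋-trans (⊕-congˡ (ltr (suc i) · δ5-4 i) (·-zeroʳ (ltr 4))) (⊕-identityˡ (ltr (suc i) · δ5-4 i)))))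

  ηSum-shuffleFour : ∀ n → 4 ≤ n → ηSum shuffleFour n 4 ≋ ltr 3 · (ltr 4 · η 5 n)
  ηSum-shuffleFour n 4≤n =
    ≋-trans (ηSum-leading shuffleFour δ5-4 3 n 4 (s≤s z≤n) (ℕP.m≤n⇒m≤1+n 4≤n) (λ i 4≤i _ → shuffleFour-∷ i 4≤i)
               (·-congˡ (ltr 4) (⧢-δ-zero (ltr 3) 3 5 ℕP.≤-refl)))
    (·-congʳ (ltr 3) (≋-trans (ηSum-leading δ5-4 ∅-at-4 4 n 4 (s≤s z≤n) (ℕP.m≤n⇒m≤1+n 4≤n) (λ i 4≤i _ → δ5-4-∷ i 4≤i)
               (·-congˡ (ltr 4) (≋-reflexive (δ-zero 3 5 ℕP.≤-refl))))
    (·-congʳ (ltr 4) (ηSum-∅-at-4 n 4≤n))))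
    where
    ηSum-∅-at-4 : ∀ n → 4 ≤ n → ηSum ∅-at-4 n 4 ≋ η 5 n
    ηSum-∅-at-4 .(4 ℕ.+ k) (s≤s (s≤s (s≤s (s≤s (z≤n {k}))))) =
      ≋-trans (⊕-cong (≋-trans (scale-1 _) (∅-⧢ (η 5 (4 ℕ.+ k)))) (sumFrom-zero 5 k _ later))
              (⊕-identityʳ (η 5 (4 ℕ.+ k)))
      where
      later : ∀ i → 5 ≤ i → i < 5 ℕ.+ k → scale (sgn i) (∅-at-4 i ⧢ η (suc i) (4 ℕ.+ k)) ≋ 𝟘
      later .(5 ℕ.+ i) (s≤s (s≤s (s≤s (s≤s (s≤s (z≤n {i})))))) _ = ≋-refl

  scale-sgn-+ : ∀ a b x → scale (sgn (a ℕ.+ b)) x ≋ scale (sgn b) (scale (sgn a) x)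
  scale-sgn-+ a b x = ≋-trans (scale-congˡ x (trans (sgn-+ a b) (*-comm (sgn a) (sgn b)))) (≋-sym (scale-scale (sgn b) (sgn a) x))

  ηPrefix : ℕ → Lin
  ηPrefix l = ltr l · η 2 (l ∸ 1)

  formulaA : ℕ → Lin
  formulaA n = ltr n · η 2 (n ∸ 1) ⊕ Σ[ 4 to n ∸ 1 ] (λ k → scale (sgn (n ℕ.+ k)) (ltr k · η 2 (k ∸ 1) ⧢ δ n (k ℕ.+ 1)))

  candidateA : ℕ → Lin
  candidateA (suc (suc (suc (suc k)))) = formulaA (4 ℕ.+ k)
  candidateA _ = 𝟘

  termA : ℕ → ℕ → Lin
  termA i l = scale (sgn l) (scale (sgn i) (ηPrefix l ⧢ δ i (suc l)))

  formulaA-as-sum : ∀ a k → a ≤ k → formulaA (4 ℕ.+ a) ≋ sumFrom 4 (suc k) (termA (4 ℕ.+ a))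
  formulaA-as-sum a k a≤k =
    begin
      ηPrefix i ⊕ Σ[ 4 to i ∸ 1 ] (λ l → scale (sgn (i ℕ.+ l)) (ηPrefix l ⧢ δ i (l ℕ.+ 1)))
    ≋⟨ ≋-trans (⊕-comm (ηPrefix i) _) (⊕-congˡ (ηPrefix i) (≋-trans (Σ-to-sumFrom 4 (i ∸ 1) _)
         (sumFrom-cong′ 4 a (λ l → ≋-trans (≋-reflexive (cong (λ b → scale (sgn (i ℕ.+ l)) (ηPrefix l ⧢ δ i b)) (ℕP.+-comm l 1)))
                                            (scale-sgn-+ i l (ηPrefix l ⧢ δ i (suc l))))))) ⟩
      sumFrom 4 a (termA i) ⊕ ηPrefix i
    ≋⟨ ⊕-congʳ (sumFrom 4 a (termA i)) (≋-sym (≋-trans (⊕-cong diagonal beyond) (⊕-identityʳ (ηPrefix i)))) ⟩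
      sumFrom 4 a (termA i) ⊕ (termA i i ⊕ sumFrom (suc i) (k ∸ a) (termA i))
    ≋⟨ ≋-sym (sumFrom-split 4 a (suc (k ∸ a)) (termA i)) ⟩
      sumFrom 4 (a ℕ.+ suc (k ∸ a)) (termA i)
    ≋⟨ ≋-reflexive (cong (λ l → sumFrom 4 l (termA i)) (trans (ℕP.+-suc a (k ∸ a)) (cong suc (ℕP.m+[n∸m]≡n a≤k)))) ⟩
      sumFrom 4 (suc k) (termA i)
    ∎
    where
    open ≋-Reasoning
    i = 4 ℕ.+ a
    diagonal : termA i i ≋ ηPrefix i
    diagonal = ≋-trans (scale-sgn-sq i (ηPrefix i ⧢ δ i (suc i))) (⧢-δ-∅ (ηPrefix i) i)
    beyond : sumFrom (suc i) (k ∸ a) (termA i) ≋ 𝟘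
    beyond = sumFrom-zero (suc i) (k ∸ a) (termA i) (λ l i<l _ →
      scale-zero (sgn l) (scale-zero (sgn i) (⧢-δ-zero (ηPrefix l) i (suc l) (s≤s i<l))))

  ηSum-candidateA : ∀ k → sumFrom 4 (suc k) (λ i → candidateA i ⧢ η (suc i) (4 ℕ.+ k)) ≋ ηPrefix (4 ℕ.+ k)
  ηSum-candidateA k =
    begin
      sumFrom 4 N (λ i → candidateA i ⧢ η (suc i) n)
    ≋⟨ sumFrom-cong 4 N (λ i 4≤i i< → as-sum i 4≤i i<) ⟩
      sumFrom 4 N (λ i → sumFrom 4 N (λ l → termA i l ⧢ η (suc i) n))
    ≋⟨ sumFrom-comm 4 N 4 N (λ i l → termA i l ⧢ η (suc i) n) ⟩
      sumFrom 4 N (λ l → sumFrom 4 N (λ i → termA i l ⧢ η (suc i) n))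
    ≋⟨ sumFrom-cong′ 4 N (λ l → ≋-trans (sumFrom-signed-⧢-η (sgn l) (λ i → ηPrefix l ⧢ δ i (suc l)) n 4)
                                        (scale-cong (sgn l) (ηSum-⧢ˡ (ηPrefix l) (λ i → δ i (suc l)) n 4))) ⟩
      sumFrom 4 N (λ l → scale (sgn l) (ηPrefix l ⧢ δη-sum (suc l) n 4))
    ≋⟨ sumFrom-last 4 k (λ l → scale (sgn l) (ηPrefix l ⧢ δη-sum (suc l) n 4)) ⟩
      sumFrom 4 k (λ l → scale (sgn l) (ηPrefix l ⧢ δη-sum (suc l) n 4)) ⊕ scale (sgn n) (ηPrefix n ⧢ δη-sum (suc n) n 4)
    ≋⟨ ⊕-cong (sumFrom-zero 4 k _ (λ l 4≤l l<n → scale-zero (sgn l)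
                 (≋-trans (⧢-congʳ (ηPrefix l) (δη-sum-vanishes l n 4 (s≤s z≤n) 4≤l l<n)) (⧢-zeroʳ (ηPrefix l)))))
              (scale-cong (sgn n) (≋-trans (⧢-congʳ (ηPrefix n) (δη-sum-top n 4 (s≤s z≤n) (s≤s (s≤s (s≤s (s≤s z≤n))))))
                                           (⧢-scale-∅ (ηPrefix n) (sgn n)))) ⟩
      𝟘 ⊕ scale (sgn n) (scale (sgn n) (ηPrefix n))
    ≋⟨ scale-sgn-sq n (ηPrefix n) ⟩
      ηPrefix n
    ∎
    where
    open ≋-Reasoning
    n = 4 ℕ.+ k
    N = suc k
    as-sum : ∀ i → 4 ≤ i → i < 4 ℕ.+ N → candidateA i ⧢ η (suc i) n ≋ sumFrom 4 N (λ l → termA i l ⧢ η (suc i) n)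
    as-sum .(4 ℕ.+ a) (s≤s (s≤s (s≤s (s≤s (z≤n {a}))))) i< =
      ≋-trans (⧢-congˡ (η (5 ℕ.+ a) n) (formulaA-as-sum a k (ℕP.≤-pred (ℕP.≤-pred (ℕP.≤-pred (ℕP.≤-pred (ℕP.≤-pred i<)))))))
              (sumFrom-⧢ˡ (η (5 ℕ.+ a) n) 4 N (termA (4 ℕ.+ a)))

  strip-1-Sσ : ∀ n → 2 ≤ n → strip 1 (Sσ n) ≋ candidateA n
  strip-1-Sσ n 2≤n = η-recursion-unique (λ i → strip 1 (Sσ i)) candidateA (λ n → strip 1 (recursionRHS n)) 2 n
    (≋-trans (strip-cong 1 Sσ-2) (strip-RHS-2 1 (λ ()))) hX hY n 2≤n ℕP.≤-refl
    where
    hX : ∀ l → 2 < l → l ≤ n → sumFrom 2 (suc l ∸ 2) (λ i → strip 1 (Sσ i) ⧢ η (suc i) l) ≋ strip 1 (recursionRHS l)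
    hX .(3 ℕ.+ m) (s≤s (s≤s (s≤s (z≤n {m})))) _ = strip-Sσ-recursion (suc m) 1 (λ ())
    hY : ∀ l → 2 < l → l ≤ n → sumFrom 2 (suc l ∸ 2) (λ i → candidateA i ⧢ η (suc i) l) ≋ strip 1 (recursionRHS l)
    hY .3 (s≤s (s≤s (s≤s (z≤n {zero})))) _ = ≋-sym strip-1-RHS-3
    hY .(4 ℕ.+ k) (s≤s (s≤s (s≤s (z≤n {suc k})))) _ = ≋-trans (ηSum-candidateA k) (≋-sym (strip-RHS-first k))

  ⊕-scale-neg : ∀ x y → x ⊕ scale -1ℤ (x ⊕ y) ≋ scale -1ℤ y
  ⊕-scale-neg x y = mk≋ λ G →
    trans (ev-++ G x (scale -1ℤ (x ⊕ y))) (trans (cong (ev G x +_) (trans (ev-scale G -1ℤ (x ⊕ y)) (cong (-1ℤ *_) (ev-++ G x y))))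
    (trans (cancel (ev G x) (ev G y)) (sym (ev-scale G -1ℤ y))))
    where
    cancel : ∀ a b → a + -1ℤ * (a + b) ≡ -1ℤ * b
    cancel = solve-∀

  word431 : Lin
  word431 = ltr 4 · ltr 3 · ltr 1

  formulaB : ℕ → Lin
  formulaB n = scale (sgn (n ℕ.+ 1)) (ltr 1 ⧢ (ltr 3 ⧢ δ n 5) · ltr 4 ⊕ ltr 4 · ltr 3 · ltr 1 ⧢ δ n 5)

  candidateB : ℕ → Lin
  candidateB 2 = ltr 1
  candidateB (suc (suc (suc (suc k)))) = formulaB (4 ℕ.+ k)
  candidateB _ = 𝟘

  formulaB-signed : ∀ i → formulaB i ≋ scale -1ℤ (scale (sgn i) (ltr 1 ⧢ shuffleFour i ⊕ word431 ⧢ δ i 5))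
  formulaB-signed i = scale-sgn-+ i 1 _

  ηSum-candidateB : ∀ k →
    ltr 1 ⧢ η 3 (4 ℕ.+ k) ⊕ sumFrom 4 (suc k) (λ i → candidateB i ⧢ η (suc i) (4 ℕ.+ k)) ≋ scale -1ℤ (word431 ⧢ δη-sum 5 (4 ℕ.+ k) 4)
  ηSum-candidateB k =
    begin
      ltr 1 ⧢ η 3 n ⊕ sumFrom 4 (suc k) (λ i → candidateB i ⧢ η (suc i) n)
    ≋⟨ ⊕-congʳ (ltr 1 ⧢ η 3 n) (≋-trans (sumFrom-cong 4 (suc k) signed) (sumFrom-signed-⧢-η -1ℤ summand n 4)) ⟩
      ltr 1 ⧢ η 3 n ⊕ scale -1ℤ (ηSum summand n 4)
    ≋⟨ ⊕-congʳ (ltr 1 ⧢ η 3 n) (scale-cong -1ℤ (≋-trans (ηSum-⊕ (λ i → ltr 1 ⧢ shuffleFour i) (λ i → word431 ⧢ δ i 5) n 4)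
         (⊕-cong (≋-trans (ηSum-⧢ˡ (ltr 1) shuffleFour n 4) (⧢-congʳ (ltr 1) (≋-trans (ηSum-shuffleFour n 4≤n) (≋-sym η3)))) 
                 (ηSum-⧢ˡ word431 (λ i → δ i 5) n 4)))) ⟩
      ltr 1 ⧢ η 3 n ⊕ scale -1ℤ (ltr 1 ⧢ η 3 n ⊕ word431 ⧢ δη-sum 5 n 4)
    ≋⟨ ⊕-scale-neg (ltr 1 ⧢ η 3 n) (word431 ⧢ δη-sum 5 n 4) ⟩
      scale -1ℤ (word431 ⧢ δη-sum 5 n 4)
    ∎
    where
    open ≋-Reasoning
    n = 4 ℕ.+ k
    4≤n : 4 ≤ n
    4≤n = s≤s (s≤s (s≤s (s≤s z≤n)))
    summand : ℕ → Lin
    summand i = ltr 1 ⧢ shuffleFour i ⊕ word431 ⧢ δ i 5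
    η3 : η 3 n ≋ ltr 3 · (ltr 4 · η 5 n)
    η3 = ≋-trans (η-∷ 3 n (s≤s (s≤s (s≤s z≤n)))) (·-congʳ (ltr 3) (η-∷ 4 n 4≤n))
    signed : ∀ i → 4 ≤ i → i < 4 ℕ.+ suc k → candidateB i ⧢ η (suc i) n ≋ scale -1ℤ (scale (sgn i) (summand i)) ⧢ η (suc i) n
    signed .(4 ℕ.+ a) (s≤s (s≤s (s≤s (s≤s (z≤n {a}))))) _ = ⧢-congˡ (η (5 ℕ.+ a) n) (formulaB-signed (4 ℕ.+ a))

  strip-2-Sσ : ∀ n → 2 ≤ n → strip 2 (Sσ n) ≋ candidateB n
  strip-2-Sσ n 2≤n = η-recursion-unique (λ i → strip 2 (Sσ i)) candidateB (λ n → strip 2 (recursionRHS n)) 2 n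
    (≋-trans (strip-cong 2 Sσ-2) strip-2-RHS-2) hX hY n 2≤n ℕP.≤-refl
    where
    hX : ∀ l → 2 < l → l ≤ n → sumFrom 2 (suc l ∸ 2) (λ i → strip 2 (Sσ i) ⧢ η (suc i) l) ≋ strip 2 (recursionRHS l)
    hX .(3 ℕ.+ m) (s≤s (s≤s (s≤s (z≤n {m})))) _ = strip-Sσ-recursion (suc m) 2 (λ ())
    hY : ∀ l → 2 < l → l ≤ n → sumFrom 2 (suc l ∸ 2) (λ i → candidateB i ⧢ η (suc i) l) ≋ strip 2 (recursionRHS l)
    hY .3 (s≤s (s≤s (s≤s (z≤n {zero})))) _ =
      ≋-trans (⊕-identityʳ (ltr 1 ⧢ η 3 3))
      (≋-trans (⧢-congʳ (ltr 1) (≋-trans (η-∷ 3 3 ℕP.≤-refl) (·-congʳ (ltr 3) (≋-reflexive (trans (η-∅ 3) (sym (η-∅ 1)))))))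
               (≋-sym (RHS.strip-RHS-penultimate 0)))
    hY .(4 ℕ.+ k) (s≤s (s≤s (s≤s (z≤n {suc k})))) _ = ≋-trans (ηSum-candidateB k) (last k)
      where
      last : ∀ k → scale -1ℤ (word431 ⧢ δη-sum 5 (4 ℕ.+ k) 4) ≋ strip 2 (recursionRHS (4 ℕ.+ k))
      last zero = ≋-trans (scale-cong -1ℤ (≋-trans (⧢-congʳ word431 (δη-sum-top 4 4 (s≤s z≤n) ℕP.≤-refl))
                                          (≋-trans (⧢-scale-∅ word431 1ℤ) (scale-1 word431))))
                          (≋-sym (≋-trans (strip-RHS-antepenultimate 0) (scale-cong -1ℤ (δη-word 2 1))))
      last (suc k') = ≋-trans (scale-zero -1ℤ (≋-trans (⧢-congʳ word431 (δη-sum-vanishes 4 (5 ℕ.+ k') 4 (s≤s z≤n) ℕP.≤-refl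
                                                                         (s≤s (s≤s (s≤s (s≤s (s≤s z≤n)))))))
                                                     (⧢-zeroʳ word431)))
                              (≋-sym (RHS.strip-RHS-vanishes (2 ℕ.+ k') 2 (λ ()) (λ ()) (λ ())))

  Xc Yc Zc : ℕ → Lin
  Xc j = ltr 1 ⧢ ltr (j ∸ 1) · η 2 (j ∸ 2) ⊖ δ (j ∸ 1) (j ∸ 2) · η 1 (j ∸ 3)
  Yc j = ltr 1 ⧢ ltr (suc j) · η 2 (j ∸ 1)
  Zc j = δ (suc (suc j)) (suc j) · η 1 (j ∸ 1)

  summandC : ℕ → ℕ → Lin
  summandC j i = Xc j ⧢ δ i (suc j) ⊕ Yc j ⧢ δ i (suc (suc j)) ⊕ Zc j ⧢ δ i (suc (suc (suc j)))

  candidateC : ℕ → ℕ → Lin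
  candidateC j i = scale (sgn (suc j)) (scale (sgn i) (summandC j i))

  formulaC : ℕ → ℕ → Lin
  formulaC j n = scale (sgn (n ℕ.+ j ℕ.+ 1))
    ((ltr 1 ⧢ ltr (j ∸ 1) · η 2 (j ∸ 2) ⊖ δ (j ∸ 1) (j ∸ 2) · η 1 (j ∸ 3)) ⧢ δ n (j ℕ.+ 1)
     ⊕ ltr 1 ⧢ ltr (j ℕ.+ 1) · η 2 (j ∸ 1) ⧢ δ n (j ℕ.+ 2)
     ⊕ δ (j ℕ.+ 2) (j ℕ.+ 1) · η 1 (j ∸ 1) ⧢ δ n (j ℕ.+ 3))

  formulaC≋candidateC : ∀ j n → formulaC j n ≋ candidateC j n
  formulaC≋candidateC j n rewrite ℕP.+-comm j 1 | ℕP.+-comm j 2 | ℕP.+-comm j 3 =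
    ≋-trans (≋-reflexive (cong (λ l → scale (sgn l) (summandC j n)) (ℕP.+-assoc n j 1)))
            (≋-trans (≋-reflexive (cong (λ l → scale (sgn (n ℕ.+ l)) (summandC j n)) (ℕP.+-comm j 1)))
                     (scale-sgn-+ n (suc j) (summandC j n)))

  module PartC (j' : ℕ) where
    j = 3 ℕ.+ j'
    X = Xc j
    Y = Yc j
    Z = Zc j
    summand = summandC j
    candidate = candidateC j

    candidate-base : strip j (Sσ j) ≋ candidate j
    candidate-base =
      ≋-trans (strip-last-Sσ j')
      (≋-sym (≋-trans (scale-scale (sgn (suc j)) (sgn j) (summand j))
             (≋-trans (scale-congˡ (summand j) (sgn-suc-* j))
             (scale-cong -1ℤ (≋-trans (⊕₃-first (⧢-δ-zero Y j (suc (suc j)) ℕP.≤-refl)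
                                                (⧢-δ-zero Z j (suc (suc (suc j))) (ℕP.n≤1+n _)))
                                      (≋-trans (⧢-δ-∅ X j) (⊖-cong ≋-refl (δη-word j' j'))))))))

    ηSum-candidate : ∀ n → sumFrom j (suc n ∸ j) (λ i → candidate i ⧢ η (suc i) n) ≋
      scale (sgn (suc j)) (X ⧢ δη-sum (suc j) n j ⊕ Y ⧢ δη-sum (suc (suc j)) n j ⊕ Z ⧢ δη-sum (suc (suc (suc j))) n j)
    ηSum-candidate n =
      ≋-trans (sumFrom-signed-⧢-η (sgn (suc j)) summand n j)
      (scale-cong (sgn (suc j))
        (≋-trans (ηSum-⊕ (λ i → X ⧢ δ i (suc j) ⊕ Y ⧢ δ i (suc (suc j))) (λ i → Z ⧢ δ i (suc (suc (suc j)))) n j)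
        (⊕-cong (≋-trans (ηSum-⊕ (λ i → X ⧢ δ i (suc j)) (λ i → Y ⧢ δ i (suc (suc j))) n j)
                         (⊕-cong (ηSum-⧢ˡ X (λ i → δ i (suc j)) n j) (ηSum-⧢ˡ Y (λ i → δ i (suc (suc j))) n j)))
                (ηSum-⧢ˡ Z (λ i → δ i (suc (suc (suc j)))) n j))))

    ⧢-δη-sum-vanishes : ∀ x k n → j ≤ k → suc k ≤ n → x ⧢ δη-sum (suc k) n j ≋ 𝟘
    ⧢-δη-sum-vanishes x k n j≤k k<n = ≋-trans (⧢-congʳ x (δη-sum-vanishes k n j (s≤s z≤n) j≤k k<n)) (⧢-zeroʳ x)

    candidate-recursion : ∀ d → let n = suc (d ℕ.+ j) in
      sumFrom j (suc n ∸ j) (λ i → candidate i ⧢ η (suc i) n) ≋ strip j (recursionRHS n)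
    candidate-recursion zero =
      ≋-trans (ηSum-candidate (suc j))
      (≋-trans (scale-cong s (⊕₃-second (⧢-δη-sum-vanishes X j (suc j) ℕP.≤-refl ℕP.≤-refl)
                                         (≋-trans (⧢-congʳ Z (δη-sum-above (suc (suc (suc j))) (suc j) j ℕP.≤-refl)) (⧢-zeroʳ Z))))
      (≋-trans (scale-cong s (≋-trans (⧢-congʳ Y (δη-sum-top (suc j) j (s≤s z≤n) (ℕP.n≤1+n j))) (⧢-scale-∅ Y s)))
      (≋-trans (scale-sgn-sq (suc j) Y)
               (≋-sym (RHS.strip-RHS-penultimate (suc j'))))))
      where s = sgn (suc j)
    candidate-recursion (suc zero) =
      ≋-trans (ηSum-candidate (suc (suc j)))
      (≋-trans (scale-cong s (⊕₃-third (⧢-δη-sum-vanishes X j (suc (suc j)) ℕP.≤-refl (ℕP.n≤1+n _))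
                                        (⧢-δη-sum-vanishes Y (suc j) (suc (suc j)) (ℕP.n≤1+n j) ℕP.≤-refl)))
      (≋-trans (scale-cong s (≋-trans (⧢-congʳ Z (δη-sum-top (suc (suc j)) j (s≤s z≤n) (ℕP.≤-trans (ℕP.n≤1+n j) (ℕP.n≤1+n _))))
                                      (⧢-scale-∅ Z (sgn (suc (suc j))))))
      (≋-trans (scale-scale s (sgn (suc (suc j))) Z)
      (≋-trans (scale-congˡ Z (trans (*-comm s (- s)) (sgn-suc-* (suc j))))
               (≋-sym (strip-RHS-antepenultimate (suc j')))))))
      where s = sgn (suc j)
    candidate-recursion (suc (suc d)) =
      ≋-trans (ηSum-candidate n)
      (≋-trans (scale-zero (sgn (suc j)) (⊕₃-none
                 (⧢-δη-sum-vanishes X j n ℕP.≤-refl (s≤s (ℕP.≤-trans (ℕP.m≤n+m j d) (ℕP.≤-trans (ℕP.n≤1+n _) (ℕP.n≤1+n _)))))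
                 (⧢-δη-sum-vanishes Y (suc j) n (ℕP.n≤1+n j) (s≤s (s≤s (ℕP.≤-trans (ℕP.m≤n+m j d) (ℕP.n≤1+n _)))))
                 (⧢-δη-sum-vanishes Z (suc (suc j)) n (ℕP.≤-trans (ℕP.n≤1+n j) (ℕP.n≤1+n _)) (s≤s (s≤s (s≤s (ℕP.m≤n+m j d)))))))
      (≋-sym (RHS.strip-RHS-vanishes (d ℕ.+ j) j (λ ())
                (λ e → ℕP.<-irrefl (sym e) (s≤s (ℕP.≤-trans (ℕP.m≤n+m j d) (ℕP.n≤1+n _))))
                (λ e → ℕP.<-irrefl (sym e) (s≤s (ℕP.m≤n+m j d))))))
      where n = suc (suc (suc (d ℕ.+ j)))

    strip-Sσ-recursion-from-j : ∀ n → j < n → sumFrom j (suc n ∸ j) (λ i → strip j (Sσ i) ⧢ η (suc i) n) ≋ strip j (recursionRHS n)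
    strip-Sσ-recursion-from-j (suc zero) (s≤s ())
    strip-Sσ-recursion-from-j (suc (suc m)) j<n =
      begin
        sumFrom j (suc n ∸ j) f
      ≋⟨ ⊕-congˡ (sumFrom j (suc n ∸ j) f) (≋-sym (sumFrom-zero 2 (suc j') f below-j)) ⟩
        sumFrom 2 (suc j') f ⊕ sumFrom (2 ℕ.+ suc j') (suc n ∸ j) f
      ≋⟨ ≋-sym (sumFrom-split 2 (suc j') (m ∸ j') f) ⟩
        sumFrom 2 (suc j' ℕ.+ (m ∸ j')) f
      ≋⟨ ≋-reflexive (cong (λ l → sumFrom 2 l f) (cong suc (ℕP.m+[n∸m]≡n j'≤m))) ⟩
        sumFrom 2 (suc m) f
      ≋⟨ strip-Sσ-recursion m j (λ e → ℕP.<-irrefl e j<n) ⟩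
        strip j (recursionRHS n)
      ∎
      where
      open ≋-Reasoning
      n = suc (suc m)
      f : ℕ → Lin
      f i = strip j (Sσ i) ⧢ η (suc i) n
      below-j : ∀ i → 2 ≤ i → i < 2 ℕ.+ suc j' → f i ≋ 𝟘
      below-j i 2≤i i<j = ⧢-congˡ (η (suc i) n) (strip-Sσ-vanishes i j 2≤i i<j)
      j'≤m : j' ≤ m
      j'≤m = ℕP.≤-trans (ℕP.n≤1+n j') (ℕP.≤-trans (ℕP.n≤1+n _) (ℕP.≤-pred (ℕP.≤-pred j<n)))

    strip-j-Sσ : ∀ n → j ≤ n → strip j (Sσ n) ≋ candidate n
    strip-j-Sσ n j≤n = η-recursion-unique (λ i → strip j (Sσ i)) candidate (λ l → strip j (recursionRHS l)) j n
      candidate-base (λ l j<l _ → strip-Sσ-recursion-from-j l j<l) hY n j≤n ℕP.≤-refl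
      where
      hY : ∀ l → j < l → l ≤ n → sumFrom j (suc l ∸ j) (λ i → candidate i ⧢ η (suc i) l) ≋ strip j (recursionRHS l)
      hY l j<l _ = subst (λ l → sumFrom j (suc l ∸ j) (λ i → candidate i ⧢ η (suc i) l) ≋ strip j (recursionRHS l))
                         (trans (sym (ℕP.+-suc (l ∸ suc j) j)) (ℕP.m∸n+n≡m j<l))
                         (candidate-recursion (l ∸ suc j))

  strip-penultimate-Sσ : ∀ k → strip (3 ℕ.+ k) (Sσ (4 ℕ.+ k)) ≋ Yc (3 ℕ.+ k) ⊕ Xc (3 ℕ.+ k) ⧢ ltr (4 ℕ.+ k)
  strip-penultimate-Sσ k =
    ≋-trans (PartC.strip-j-Sσ k (4 ℕ.+ k) (ℕP.n≤1+n _))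
    (≋-trans (scale-sgn-sq (4 ℕ.+ k) (summandC j (4 ℕ.+ k)))
    (≋-trans (⊕₃-first′ (⧢-congʳ (Xc j) (δ-single j)) (⧢-δ-∅ (Yc j) (suc j)) (⧢-δ-zero (Zc j) (suc j) (suc (suc (suc j))) ℕP.≤-refl))
             (⊕-comm (Xc j ⧢ ltr (suc j)) (Yc j))))
    where
    j = 3 ℕ.+ k
    ⊕₃-first′ : ∀ {x x' y y' z} → x ≋ x' → y ≋ y' → z ≋ 𝟘 → x ⊕ y ⊕ z ≋ x' ⊕ y'
    ⊕₃-first′ {x' = x'} {y' = y'} x≋ y≋ z≋0 = ≋-trans (⊕-cong (⊕-cong x≋ y≋) z≋0) (⊕-identityʳ (x' ⊕ y'))

  ⊖-negate : ∀ x y → scale -1ℤ (x ⊖ y) ≋ y ⊖ x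
  ⊖-negate x y = mk≋ λ G → trans (ev-scale G -1ℤ (x ⊖ y)) (trans (cong (-1ℤ *_) (ev-⊖ G x y))
    (trans (negate (ev G x) (ev G y)) (sym (ev-⊖ G y x))))
    where
    negate : ∀ a b → -1ℤ * (a - b) ≡ b - a
    negate = solve-∀

  strip-last-Sσ-δη : ∀ k → strip (4 ℕ.+ k) (Sσ (4 ℕ.+ k)) ≋
    δ (3 ℕ.+ k) (2 ℕ.+ k) · η 1 (1 ℕ.+ k) ⊖ ltr 1 ⧢ ltr (3 ℕ.+ k) · η 2 (2 ℕ.+ k)
  strip-last-Sσ-δη k = ≋-trans (strip-last-Sσ (suc k))
    (≋-trans (⊖-negate (ltr 1 ⧢ ltr (3 ℕ.+ k) · η 2 (2 ℕ.+ k)) ⟪ σₙ (3 ℕ.+ k) ⟫)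
             (⊖-cong (≋-sym (δη-word (suc k) (suc k))) ≋-refl))

open import Data.Nat using (ℕ; _≤_; _∸_; _+_; zero; suc; z≤n; s≤s)
import Data.Nat.Properties as ℕP
open import Data.Product using (_×_; _,_)

lemma3p6 : (n : ℕ) → 4 ≤ n →
    (S* (σₙ n) 1 ≈ ltr n · η 2 (n ∸ 1)
        ⊕ Σ[ 4 to n ∸ 1 ] (λ k → scale (sgn (n + k)) (ltr k · η 2 (k ∸ 1) ⧢ δ n (k + 1))))
    × (S* (σₙ n) 2 ≈ scale (sgn (n + 1))
        (ltr 1 ⧢ (ltr 3 ⧢ δ n 5) · ltr 4 ⊕ ltr 4 · ltr 3 · ltr 1 ⧢ δ n 5))
    × ((j : ℕ) → 3 ≤ j → j ≤ n ∸ 2 →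
        S* (σₙ n) j ≈ scale (sgn (n + j + 1))
          ((ltr 1 ⧢ ltr (j ∸ 1) · η 2 (j ∸ 2) ⊖ δ (j ∸ 1) (j ∸ 2) · η 1 (j ∸ 3)) ⧢ δ n (j + 1)
           ⊕ ltr 1 ⧢ ltr (j + 1) · η 2 (j ∸ 1) ⧢ δ n (j + 2)
           ⊕ δ (j + 2) (j + 1) · η 1 (j ∸ 1) ⧢ δ n (j + 3)))
    × (S* (σₙ n) (n ∸ 1) ≈ ltr 1 ⧢ ltr n · η 2 (n ∸ 2)
        ⊕ (ltr 1 ⧢ ltr (n ∸ 2) · η 2 (n ∸ 3) ⊖ δ (n ∸ 2) (n ∸ 3) · η 1 (n ∸ 4)) ⧢ ltr n)
    × (S* (σₙ n) n ≈ δ (n ∸ 1) (n ∸ 2) · η 1 (n ∸ 3) ⊖ ltr 1 ⧢ ltr (n ∸ 1) · η 2 (n ∸ 2))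
lemma3p6 .(4 + k) (s≤s (s≤s (s≤s (s≤s (z≤n {k}))))) =
  ≋⇒≈ (strip-1-Sσ n 2≤n) ,
  ≋⇒≈ (strip-2-Sσ n 2≤n) ,
  part-c ,
  ≋⇒≈ (strip-penultimate-Sσ k) ,
  ≋⇒≈ (strip-last-Sσ-δη k)
  where
  n = 4 + k
  2≤n : 2 ≤ n
  2≤n = s≤s (s≤s z≤n)
  part-c : ∀ j → 3 ≤ j → j ≤ n ∸ 2 → S* (σₙ n) j ≈ formulaC j n
  part-c .(3 + j') (s≤s (s≤s (s≤s (z≤n {j'})))) j≤n-2 =
    ≋⇒≈ (≋-trans (PartC.strip-j-Sσ j' n (ℕP.≤-trans j≤n-2 (ℕP.m∸n≤m n 2))) (≋-sym (formulaC≋candidateC (3 + j') n)))
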